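{- Let $k\ge 3$, let $g$ be even, and let $\mathbf{a}=(a_1,\ldots,a_k)$ be such that a girth-regular graph of valency $k$, girth $g$ and signature $\mathbf{a}$ exists. Write $s=\sum_{i=1}^k a_i$. If $g\equiv 0\pmod 4$, then $$n(k,g,\mathbf{a})\ge\frac{c(g,k)+s+k^{g}-2c(\tfrac{g}{2},k)k^{\frac{g}{2}}}{c(g,k)-c^2(\tfrac{g}{2},k)+s},\qquad n_2(k,g,\mathbf{a})\ge2\,\frac{c(g,k)+s+k^{g}-2c(\tfrac{g}{2},k)k^{\frac{g}{2}}}{c(g,k)-c^2(\tfrac{g}{2},k)+s}.$$ If $g\equiv 2\pmod 4$, then $$n(k,g,\mathbf{a})\ge\frac{c(g,k)+s+k^g}{c(g,k)+s},\qquad n_2(k,g,\mathbf{a})\ge\frac{2k^g}{c(g,k)+s}.$$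
   Context: All graphs are simple, finite and connected, and valency $k>2$ is assumed throughout. For a $k$-regular graph of girth $g$, the signature of a vertex $v$ is the sequence $(a_1,\ldots,a_k)$, listed in non-decreasing order, of the numbers of $g$-cycles containing each of the $k$ edges incident with $v$; the graph is girth-regular if all vertices have the same signature, which is then called the signature of the graph. $n(k,g,\mathbf{a})$ denotes the smallest order of a girth-regular graph of valency $k$, girth $g$ and signature $\mathbf{a}$, and $n_2(k,g,\mathbf{a})$ the smallest order of such a graph that is bipartite (when one exists). For an even integer $\ell$, $c(\ell,k)$ denotes the number of closed walks of length $\ell$ starting at a given vertex that contain no cycle, i.e. the number of closed walks of length $\ell$ from a fixed vertex in the infinite $k$-regular tree (a polynomial in $k$ of degree $\ell/2$). -}

module Defs where

open import Data.Nat as ℕ using (ℕ; zero; suc; _∸_; _^_; _≤ᵇ_)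
open import Data.Bool using (Bool; true; false; _∧_; not)
open import Data.Fin as Fin using (Fin)
open import Data.List using (List; []; _∷_; length; map; concatMap; allFin; filterᵇ)
open import Data.Bool.ListAction using (any)
open import Data.Vec as Vec using (Vec)
open import Data.Product using (Σ; ∃; _×_)
open import Relation.Binary.PropositionalEquality using (_≡_; _≢_)
open import Relation.Nullary.Decidable using (⌊_⌋)
open import Data.List.Relation.Binary.Permutation.Propositional using (_↭_)
open import Data.Integer as ℤ using (ℤ; +_)

record Graph (n : ℕ) : Set where
  field
    adj    : Fin n → Fin n → Bool
    sym    : ∀ i j → adj i j ≡ adj j i
    irrefl : ∀ i → adj i i ≡ false
open Graph public

module _ {n : ℕ} (G : Graph n) where

  neighbours : Fin n → List (Fin n)
  neighbours v = filterᵇ (adj G v) (allFin n)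

  degree : Fin n → ℕ
  degree v = length (neighbours v)

  Regular : ℕ → Set
  Regular k = ∀ v → degree v ≡ k

  data Walk : Fin n → Fin n → Set where
    here : ∀ {u} → Walk u u
    step : ∀ {u w v} → adj G u w ≡ true → Walk w v → Walk u v

  Connected : Set
  Connected = ∀ u v → Walk u v

  allDistinct : List (Fin n) → Bool
  allDistinct []       = true
  allDistinct (x ∷ xs) = not (any (λ y → ⌊ x Fin.≟ y ⌋) xs) ∧ allDistinct xs

  pathᵇ : List (Fin n) → Bool
  pathᵇ (x ∷ y ∷ xs) = adj G x y ∧ pathᵇ (y ∷ xs)
  pathᵇ _            = true

  lastOr : Fin n → List (Fin n) → Fin n
  lastOr x []       = x
  lastOr x (y ∷ ys) = lastOr y ys

  closeᵇ : List (Fin n) → Bool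
  closeᵇ []       = false
  closeᵇ (x ∷ xs) = adj G (lastOr x xs) x

  isCycleᵇ : List (Fin n) → Bool
  isCycleᵇ xs = (3 ≤ᵇ length xs) ∧ (allDistinct xs ∧ (pathᵇ xs ∧ closeᵇ xs))

  Girth : ℕ → Set
  Girth g = (Σ (List (Fin n)) λ xs → length xs ≡ g × isCycleᵇ xs ≡ true)
          × (∀ xs → isCycleᵇ xs ≡ true → g ℕ.≤ length xs)

  allLists : ℕ → List (List (Fin n))
  allLists zero    = [] ∷ []
  allLists (suc m) = concatMap (λ x → map (x ∷_) (allLists m)) (allFin n)

  startsWithᵇ : Fin n → Fin n → List (Fin n) → Bool
  startsWithᵇ u w (x ∷ y ∷ _) = ⌊ u Fin.≟ x ⌋ ∧ ⌊ w Fin.≟ y ⌋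
  startsWithᵇ u w _           = false

  -- number of g-cycles through the edge uw: every such cycle corresponds to
  -- exactly one vertex sequence x₀ … x_{g-1} with x₀ = u, x₁ = w
  cycleCount : ℕ → Fin n → Fin n → ℕ
  cycleCount g u w =
    length (filterᵇ (λ xs → isCycleᵇ xs ∧ startsWithᵇ u w xs) (allLists g))

  signatureList : ℕ → Fin n → List ℕ
  signatureList g v = map (cycleCount g v) (neighbours v)

  Bipartite : Set
  Bipartite = Σ (Fin n → Bool) λ col → ∀ u v → adj G u v ≡ true → col u ≢ col v

NonDecreasing : {k : ℕ} → Vec ℕ k → Set
NonDecreasing {k} a = ∀ (i j : Fin k) → i Fin.≤ j → Vec.lookup a i ℕ.≤ Vec.lookup a j

GirthRegular : {n : ℕ} → Graph n → (k g : ℕ) → Vec ℕ k → Set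
GirthRegular G k g a =
  Connected G × Regular G k × Girth G g
  × (∀ v → signatureList G g v ↭ Vec.toList a)

GirthRegularExists : (k g : ℕ) → Vec ℕ k → Set
GirthRegularExists k g a = Σ ℕ λ n → Σ (Graph n) λ G → GirthRegular G k g a

IsMinOrder : (k g : ℕ) → Vec ℕ k → ℕ → Set
IsMinOrder k g a m =
  (Σ (Graph m) λ G → GirthRegular G k g a)
  × (∀ n (G : Graph n) → GirthRegular G k g a → m ℕ.≤ n)

IsMinOrder₂ : (k g : ℕ) → Vec ℕ k → ℕ → Set
IsMinOrder₂ k g a m =
  (Σ (Graph m) λ G → GirthRegular G k g a × Bipartite G)
  × (∀ n (G : Graph n) → GirthRegular G k g a → Bipartite G → m ℕ.≤ n)

-- c(ℓ,k): closed walks of length ℓ from the root of the infinite k-regular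
-- tree.  treeWalks k ℓ d = number of walks of length ℓ from a vertex at
-- distance d from the root to the root (the root has k children; every
-- other vertex has one parent and k-1 children).

treeWalks : ℕ → ℕ → ℕ → ℕ
treeWalks k zero    zero    = 1
treeWalks k zero    (suc d) = 0
treeWalks k (suc ℓ) zero    = k ℕ.* treeWalks k ℓ 1
treeWalks k (suc ℓ) (suc d) = treeWalks k ℓ d ℕ.+ (k ∸ 1) ℕ.* treeWalks k ℓ (suc (suc d))

c : ℕ → ℕ → ℕ
c ℓ k = treeWalks k ℓ 0

num0 : (k g s : ℕ) → ℤ
num0 k g s = + c g k ℤ.+ + s ℤ.+ + (k ^ g)
             ℤ.- + 2 ℤ.* + c (g ℕ./ 2) k ℤ.* + (k ^ (g ℕ./ 2))

den0 : (k g s : ℕ) → ℤ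
den0 k g s = + c g k ℤ.- + c (g ℕ./ 2) k ℤ.* + c (g ℕ./ 2) k ℤ.+ + s

num2 : (k g s : ℕ) → ℤ
num2 k g s = + c g k ℤ.+ + s ℤ.+ + (k ^ g)

num2bip : (k g s : ℕ) → ℤ
num2bip k g s = + 2 ℤ.* + (k ^ g)

den2 : (k g s : ℕ) → ℤ
den2 k g s = + c g k ℤ.+ + s

-- Let h = g/2 and let M = A^h count the walks of length h.  The matrices A_d counting
-- non-backtracking walks obey the recursion of the k-regular tree, so that
-- A^ℓ = Σ_d treeWalks k ℓ d · A_d.  A closed non-backtracking walk shorter than g would
-- contain a cycle, and one of length g runs once around a g-cycle; hence M_uu = c(h,k)
-- and Σ_v M_uv² = (A^g)_uu = c(g,k) + s, while every row of M sums to k^h.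
-- Cauchy–Schwarz on the off-diagonal entries of row u, supported on N vertices, gives
-- (k^h − c(h,k))² ≤ (N − 1)(c(g,k) + s − c(h,k)²), which rearranges to the bound with
-- N = n.  If g ≡ 2 (mod 4) then h is odd and c(h,k) = 0.  In a bipartite graph the row
-- of u is supported on the colour class of u when h is even and on the other class when
-- h is odd; adding the bounds obtained from both classes gives the factor 2.

module Submission where

open import Data.Nat using (ℕ; _%_)
open import Data.Vec using (Vec)
open import Relation.Binary.PropositionalEquality using (_≡_)
open import Defs using (Graph; Regular; Girth; GirthRegular)

module Sums where

  open import Data.Bool using (Bool; true; false; not)
  open import Data.Fin using (Fin; zero; suc; toℕ)
  open import Data.List using (List; []; _∷_; _++_; length; map; filterᵇ; tabulate; concatMap)
  open import Data.List.Properties using (map-++)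
  open import Data.Nat using (ℕ; zero; suc; _+_; _*_; _∸_; _≤_; _<_; z≤n; s≤s)
  open import Data.Nat.ListAction using (sum)
  open import Data.Nat.ListAction.Properties using (sum-++)
  open import Data.Nat.Properties
  open import Data.Nat.Tactic.RingSolver using (solve-∀)
  open import Data.Product using (_,_)
  open import Data.Sum using (inj₁; inj₂)
  open import Data.Vec as Vec using (Vec)
  open import Function using (_∘_)
  open import Relation.Binary.PropositionalEquality
  open import Relation.Nullary using (contradiction)
  open import Algebra.Properties.Semiring.Sum +-*-semiring
    using (sum-cong-≗; ∑-distrib-+; ∑-comm; *-distribˡ-sum; *-distribʳ-sum; sum-remove)
    renaming (sum to ∑) public

  ⟦_⟧ : Bool → ℕ
  ⟦ true ⟧  = 1
  ⟦ false ⟧ = 0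

  count : ∀ {n} → (Fin n → Bool) → ℕ
  count p = ∑ λ i → ⟦ p i ⟧

  δ : ∀ {n} → Fin n → Fin n → ℕ
  δ zero    zero    = 1
  δ zero    (suc _) = 0
  δ (suc _) zero    = 0
  δ (suc i) (suc j) = δ i j

  δ-refl : ∀ {n} (i : Fin n) → δ i i ≡ 1
  δ-refl zero    = refl
  δ-refl (suc i) = δ-refl i

  δ-≢ : ∀ {n} {i j : Fin n} → i ≢ j → δ i j ≡ 0
  δ-≢ {i = zero}  {zero}  i≢j = contradiction refl i≢j
  δ-≢ {i = zero}  {suc j} i≢j = refl
  δ-≢ {i = suc i} {zero}  i≢j = refl
  δ-≢ {i = suc i} {suc j} i≢j = δ-≢ (i≢j ∘ cong suc)

  δ-sym : ∀ {n} (i j : Fin n) → δ i j ≡ δ j i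
  δ-sym zero    zero    = refl
  δ-sym zero    (suc j) = refl
  δ-sym (suc i) zero    = refl
  δ-sym (suc i) (suc j) = δ-sym i j

  δ≤1 : ∀ {n} (i j : Fin n) → δ i j ≤ 1
  δ≤1 zero    zero    = s≤s z≤n
  δ≤1 zero    (suc _) = z≤n
  δ≤1 (suc _) zero    = z≤n
  δ≤1 (suc i) (suc j) = δ≤1 i j

  δᶜ : ∀ {n} → Fin n → Fin n → ℕ
  δᶜ i j = 1 ∸ δ i j

  δᶜ-refl : ∀ {n} (i : Fin n) → δᶜ i i ≡ 0
  δᶜ-refl i = cong (1 ∸_) (δ-refl i)

  δᶜ-≢ : ∀ {n} {i j : Fin n} → i ≢ j → δᶜ i j ≡ 1
  δᶜ-≢ i≢j = cong (1 ∸_) (δ-≢ i≢j)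

  δᶜ-sym : ∀ {n} (i j : Fin n) → δᶜ i j ≡ δᶜ j i
  δᶜ-sym i j = cong (1 ∸_) (δ-sym i j)

  δᶜ+δ≡1 : ∀ {n} (i j : Fin n) → δᶜ i j + δ i j ≡ 1
  δᶜ+δ≡1 i j = m∸n+n≡m (δ≤1 i j)

  ∑-zero : ∀ {n} (f : Fin n → ℕ) → (∀ i → f i ≡ 0) → ∑ f ≡ 0
  ∑-zero {zero}  f f≡0 = refl
  ∑-zero {suc n} f f≡0 = cong₂ _+_ (f≡0 zero) (∑-zero (f ∘ suc) (f≡0 ∘ suc))

  ∑-single : ∀ {n} (i : Fin n) (f : Fin n → ℕ) → (∀ j → j ≢ i → f j ≡ 0) → ∑ f ≡ f i
  ∑-single zero    f f≡0 = trans (cong (f zero +_) (∑-zero (f ∘ suc) λ j → f≡0 (suc j) λ ())) (+-identityʳ _)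
  ∑-single (suc i) f f≡0 = trans (cong (_+ ∑ (f ∘ suc)) (f≡0 zero λ ()))
    (∑-single i (f ∘ suc) λ j j≢i → f≡0 (suc j) λ { refl → j≢i refl })

  ∑-δ : ∀ {n} (i : Fin n) (f : Fin n → ℕ) → ∑ (λ j → δ i j * f j) ≡ f i
  ∑-δ i f = trans (∑-single i _ λ j j≢i → cong (_* f j) (δ-≢ (≢-sym j≢i)))
                  (trans (cong (_* f i) (δ-refl i)) (+-identityʳ (f i)))

  ∑-δᶜ : ∀ {n} (i : Fin n) (f : Fin n → ℕ) → ∑ f ≡ ∑ (λ j → δᶜ i j * f j) + f i
  ∑-δᶜ i f = begin
    ∑ f                                             ≡⟨ sum-cong-≗ split ⟩
    ∑ (λ j → δᶜ i j * f j + δ i j * f j)            ≡⟨ ∑-distrib-+ (λ j → δᶜ i j * f j) (λ j → δ i j * f j) ⟩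
    ∑ (λ j → δᶜ i j * f j) + ∑ (λ j → δ i j * f j)  ≡⟨ cong (∑ (λ j → δᶜ i j * f j) +_) (∑-δ i f) ⟩
    ∑ (λ j → δᶜ i j * f j) + f i                    ∎
    where
    open ≡-Reasoning
    split : ∀ j → f j ≡ δᶜ i j * f j + δ i j * f j
    split j = sym (trans (sym (*-distribʳ-+ (f j) (δᶜ i j) (δ i j)))
                         (trans (cong (_* f j) (δᶜ+δ≡1 i j)) (+-identityʳ (f j))))

  count-true : ∀ {n} → count {n} (λ _ → true) ≡ n
  count-true {zero}  = refl
  count-true {suc n} = cong suc count-true

  count-complement : ∀ {n} (p : Fin n → Bool) → count p + count (not ∘ p) ≡ n
  count-complement p =
    trans (sym (∑-distrib-+ (λ i → ⟦ p i ⟧) (λ i → ⟦ not (p i) ⟧))) (trans (sum-cong-≗ (one ∘ p)) count-true)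
    where
    one : ∀ b → ⟦ b ⟧ + ⟦ not b ⟧ ≡ 1
    one true  = refl
    one false = refl

  ∑-mono-≤ : ∀ {n} {f g : Fin n → ℕ} → (∀ i → f i ≤ g i) → ∑ f ≤ ∑ g
  ∑-mono-≤ {zero}  f≤g = z≤n
  ∑-mono-≤ {suc n} f≤g = +-mono-≤ (f≤g zero) (∑-mono-≤ (f≤g ∘ suc))

  ∑-*-∑ : ∀ {m n} (f : Fin m → ℕ) (g : Fin n → ℕ) → ∑ f * ∑ g ≡ ∑ λ i → ∑ λ j → f i * g j
  ∑-*-∑ f g = trans (*-distribʳ-sum (∑ g) f) (sum-cong-≗ λ i → *-distribˡ-sum (f i) g)

  2ab≤a²+b²-ordered : ∀ {a b} → a ≤ b → 2 * (a * b) ≤ a * a + b * b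
  2ab≤a²+b²-ordered {a} a≤b with m≤n⇒∃[o]m+o≡n a≤b
  ... | d , refl = subst (2 * (a * (a + d)) ≤_) (expand a d) (m≤m+n _ (d * d))
    where
    expand : ∀ a d → 2 * (a * (a + d)) + d * d ≡ a * a + (a + d) * (a + d)
    expand = solve-∀

  2ab≤a²+b² : ∀ a b → 2 * (a * b) ≤ a * a + b * b
  2ab≤a²+b² a b with ≤-total a b
  ... | inj₁ a≤b = 2ab≤a²+b²-ordered a≤b
  ... | inj₂ b≤a = subst₂ _≤_ (cong (2 *_) (*-comm b a)) (+-comm (b * b) (a * a)) (2ab≤a²+b²-ordered b≤a)

  cauchy-schwarz : ∀ {n} (f g : Fin n → ℕ) →
    ∑ (λ i → f i * g i) * ∑ (λ i → f i * g i) ≤ ∑ (λ i → f i * f i) * ∑ (λ i → g i * g i)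
  cauchy-schwarz {n} f g = *-cancelˡ-≤ 2 (begin
    2 * (∑ fg * ∑ fg)                                  ≡⟨ cong (2 *_) (trans (∑-*-∑ fg fg) mixed) ⟩
    2 * ∑ (λ i → ∑ λ j → a i j * a j i)                ≡⟨ double ⟩
    ∑ (λ i → ∑ λ j → 2 * (a i j * a j i))              ≤⟨ ∑-mono-≤ (λ i → ∑-mono-≤ λ j → am-gm i j) ⟩
    ∑ (λ i → ∑ λ j → a i j * a i j + a j i * a j i)    ≡⟨ split ⟩
    ∑ (λ i → ∑ λ j → a i j * a i j) + ∑ (λ i → ∑ λ j → a j i * a j i)
                                                       ≡⟨ cong (X +_) (∑-comm (λ i j → a j i * a j i)) ⟩
    X + X                                              ≡⟨ cong (λ x → x + x) X≡∑ff*∑gg ⟩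
    ∑ ff * ∑ gg + ∑ ff * ∑ gg                          ≡⟨ cong (∑ ff * ∑ gg +_) (sym (+-identityʳ _)) ⟩
    2 * (∑ ff * ∑ gg)                                  ∎)
    where
    open ≤-Reasoning
    fg ff gg : Fin n → ℕ
    fg i = f i * g i
    ff i = f i * f i
    gg i = g i * g i
    a : Fin n → Fin n → ℕ
    a i j = f i * g j
    X = ∑ λ i → ∑ λ j → a i j * a i j
    am-gm : ∀ i j → 2 * (a i j * a j i) ≤ a i j * a i j + a j i * a j i
    am-gm i j = 2ab≤a²+b² (a i j) (a j i)
    swap : ∀ x y z w → (x * y) * (z * w) ≡ (x * w) * (z * y)
    swap = solve-∀
    square : ∀ x y → (x * y) * (x * y) ≡ (x * x) * (y * y)
    square = solve-∀
    mixed : ∑ (λ i → ∑ λ j → fg i * fg j) ≡ ∑ (λ i → ∑ λ j → a i j * a j i)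
    mixed = sum-cong-≗ λ i → sum-cong-≗ λ j → swap (f i) (g i) (f j) (g j)
    double : 2 * ∑ (λ i → ∑ λ j → a i j * a j i) ≡ ∑ (λ i → ∑ λ j → 2 * (a i j * a j i))
    double = trans (*-distribˡ-sum 2 (λ i → ∑ λ j → a i j * a j i))
                   (sum-cong-≗ λ i → *-distribˡ-sum 2 (λ j → a i j * a j i))
    split : ∑ (λ i → ∑ λ j → a i j * a i j + a j i * a j i)
          ≡ ∑ (λ i → ∑ λ j → a i j * a i j) + ∑ (λ i → ∑ λ j → a j i * a j i)
    split = trans (sum-cong-≗ λ i → ∑-distrib-+ (λ j → a i j * a i j) (λ j → a j i * a j i))
                  (∑-distrib-+ (λ i → ∑ λ j → a i j * a i j) (λ i → ∑ λ j → a j i * a j i))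
    X≡∑ff*∑gg : X ≡ ∑ ff * ∑ gg
    X≡∑ff*∑gg = trans (sum-cong-≗ λ i → sum-cong-≗ λ j → square (f i) (g j)) (sym (∑-*-∑ ff gg))

  cauchy-schwarz-support : ∀ {n} (p : Fin n → Bool) (x : Fin n → ℕ) → (∀ i → p i ≡ false → x i ≡ 0) →
    ∑ x * ∑ x ≤ count p * ∑ (λ i → x i * x i)
  cauchy-schwarz-support p x x≡0 =
    subst₂ _≤_ (cong₂ _*_ ∑-restrict ∑-restrict) (cong₂ _*_ (sum-cong-≗ (idem ∘ p)) refl)
      (cauchy-schwarz (⟦_⟧ ∘ p) x)
    where
    restrict : ∀ i → ⟦ p i ⟧ * x i ≡ x i
    restrict i with p i in pᵢ
    ... | true  = +-identityʳ (x i)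
    ... | false = sym (x≡0 i pᵢ)
    ∑-restrict : ∑ (λ i → ⟦ p i ⟧ * x i) ≡ ∑ x
    ∑-restrict = sum-cong-≗ restrict
    idem : ∀ b → ⟦ b ⟧ * ⟦ b ⟧ ≡ ⟦ b ⟧
    idem true  = refl
    idem false = refl

  ∑< : ℕ → (ℕ → ℕ) → ℕ
  ∑< B f = ∑ λ (d : Fin B) → f (toℕ d)

  ∑<-cong : ∀ B {f g : ℕ → ℕ} → (∀ d → f d ≡ g d) → ∑< B f ≡ ∑< B g
  ∑<-cong B f≡g = sum-cong-≗ {B} (f≡g ∘ toℕ)

  ∑<-distrib-+ : ∀ B (f g : ℕ → ℕ) → ∑< B (λ d → f d + g d) ≡ ∑< B f + ∑< B g
  ∑<-distrib-+ B f g = ∑-distrib-+ {B} (f ∘ toℕ) (g ∘ toℕ)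

  ∑<-*ˡ : ∀ B c (f : ℕ → ℕ) → ∑< B (λ d → c * f d) ≡ c * ∑< B f
  ∑<-*ˡ B c f = sym (*-distribˡ-sum {B} c (f ∘ toℕ))

  ∑<-snoc : ∀ B (f : ℕ → ℕ) → ∑< (suc B) f ≡ ∑< B f + f B
  ∑<-snoc zero    f = +-identityʳ (f 0)
  ∑<-snoc (suc B) f = trans (cong (f 0 +_) (∑<-snoc B (f ∘ suc))) (sym (+-assoc (f 0) _ _))

  ∑<-drop-zeros : ∀ B (f : ℕ → ℕ) → f B ≡ 0 → f (suc B) ≡ 0 → ∑< (2 + B) f ≡ ∑< B f
  ∑<-drop-zeros B f fB≡0 fB+1≡0 = begin
    ∑< (2 + B) f                ≡⟨ ∑<-snoc (suc B) f ⟩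
    ∑< (suc B) f + f (suc B)    ≡⟨ cong₂ _+_ (∑<-snoc B f) fB+1≡0 ⟩
    ∑< B f + f B + 0            ≡⟨ +-identityʳ _ ⟩
    ∑< B f + f B                ≡⟨ cong (∑< B f +_) fB≡0 ⟩
    ∑< B f + 0                  ≡⟨ +-identityʳ _ ⟩
    ∑< B f                      ∎
    where open ≡-Reasoning

  ∑<-single : ∀ {B e} (f : ℕ → ℕ) → e < B → (∀ d → d ≢ e → f d ≡ 0) → ∑< B f ≡ f e
  ∑<-single {suc B} {zero}  f _         f≡0 =
    trans (cong (f 0 +_) (∑-zero {B} (f ∘ suc ∘ toℕ) λ d → f≡0 (suc (toℕ d)) λ ())) (+-identityʳ (f 0))
  ∑<-single {suc B} {suc e} f (s≤s e<B) f≡0 = trans (cong (_+ ∑< B (f ∘ suc)) (f≡0 0 λ ()))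
    (∑<-single (f ∘ suc) e<B λ d d≢e → f≡0 (suc d) (d≢e ∘ suc-injective))

  sum-map-tabulate : ∀ {n} {X : Set} (f : X → ℕ) (g : Fin n → X) → sum (map f (tabulate g)) ≡ ∑ (f ∘ g)
  sum-map-tabulate {zero}  f g = refl
  sum-map-tabulate {suc n} f g = cong (f (g zero) +_) (sum-map-tabulate f (g ∘ suc))

  sum-map-filterᵇ : ∀ {X : Set} (p : X → Bool) (f : X → ℕ) xs →
    sum (map f (filterᵇ p xs)) ≡ sum (map (λ x → ⟦ p x ⟧ * f x) xs)
  sum-map-filterᵇ p f []       = refl
  sum-map-filterᵇ p f (x ∷ xs) with p x
  ... | true  = cong₂ _+_ (sym (+-identityʳ (f x))) (sum-map-filterᵇ p f xs)
  ... | false = sum-map-filterᵇ p f xs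

  length-filterᵇ : ∀ {X : Set} (p : X → Bool) xs → length (filterᵇ p xs) ≡ sum (map (⟦_⟧ ∘ p) xs)
  length-filterᵇ p []       = refl
  length-filterᵇ p (x ∷ xs) with p x
  ... | true  = cong suc (length-filterᵇ p xs)
  ... | false = length-filterᵇ p xs

  sum-map-concatMap : ∀ {X Y : Set} (f : Y → ℕ) (h : X → List Y) xs →
    sum (map f (concatMap h xs)) ≡ sum (map (λ x → sum (map f (h x))) xs)
  sum-map-concatMap f h []       = refl
  sum-map-concatMap f h (x ∷ xs) = begin
    sum (map f (h x ++ concatMap h xs))                          ≡⟨ cong sum (map-++ f (h x) (concatMap h xs)) ⟩
    sum (map f (h x) ++ map f (concatMap h xs))                  ≡⟨ sum-++ (map f (h x)) _ ⟩
    sum (map f (h x)) + sum (map f (concatMap h xs))             ≡⟨ cong (sum (map f (h x)) +_) (sum-map-concatMap f h xs) ⟩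
    sum (map f (h x)) + sum (map (λ x → sum (map f (h x))) xs)   ∎
    where open ≡-Reasoning

  sum-toList : ∀ {m} (a : Vec ℕ m) → sum (Vec.toList a) ≡ Vec.sum a
  sum-toList Vec.[]       = refl
  sum-toList (x Vec.∷ a) = cong (x +_) (sum-toList a)

module Variance where

  open import Data.Bool using (Bool; true; false)
  open import Data.Fin using (Fin; punchIn)
  open import Data.Integer using (+_; _+_; _-_; _*_; _≤_; 1ℤ; +≤+)
  open import Data.Integer.Properties using (pos-+; pos-*; +-monoˡ-≤; module ≤-Reasoning)
  open import Data.Integer.Tactic.RingSolver using (solve-∀)
  import Data.Nat as ℕ
  open import Data.Vec.Functional using (removeAt)
  open import Function using (_∘_)
  open import Relation.Binary.PropositionalEquality
  open Sums

  off-diagonal-cauchy-schwarz : ∀ {n} (p : Fin n → Bool) (x : Fin n → ℕ.ℕ) u → p u ≡ true →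
    (∀ i → p i ≡ false → x i ≡ 0) →
    (+ ∑ x - + x u) * (+ ∑ x - + x u) ≤ (+ count p - 1ℤ) * (+ ∑ (λ i → x i ℕ.* x i) - + x u * + x u)
  off-diagonal-cauchy-schwarz {ℕ.suc n} p x u pu x≡0 =
    subst₂ _≤_ lhs rhs (+≤+ (cauchy-schwarz-support p′ x′ (x≡0 ∘ punchIn u)))
    where
    p′ = removeAt p u
    x′ = removeAt x u
    cancel : ∀ a b → + (a ℕ.+ b) - + a ≡ + b
    cancel a b = trans (cong (_- + a) (pos-+ a b)) (a+b-a (+ a) (+ b))
      where
      a+b-a : ∀ a b → a + b - a ≡ b
      a+b-a = solve-∀
    ∑x : + ∑ x - + x u ≡ + ∑ x′
    ∑x = trans (cong (λ m → + m - + x u) (sum-remove {i = u} x)) (cancel (x u) (∑ x′))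
    ∑x² : + ∑ (λ i → x i ℕ.* x i) - + x u * + x u ≡ + ∑ (λ i → x′ i ℕ.* x′ i)
    ∑x² = trans (cong₂ (λ m z → + m - z) (sum-remove {i = u} (λ i → x i ℕ.* x i)) (sym (pos-* (x u) (x u))))
                (cancel (x u ℕ.* x u) (∑ (λ i → x′ i ℕ.* x′ i)))
    count′ : + count p - 1ℤ ≡ + count p′
    count′ = trans (cong (λ m → + m - 1ℤ) (trans (sum-remove {i = u} (⟦_⟧ ∘ p)) (cong (λ b → ⟦ b ⟧ ℕ.+ count p′) pu)))
                   (cancel 1 (count p′))
    lhs : + (∑ x′ ℕ.* ∑ x′) ≡ (+ ∑ x - + x u) * (+ ∑ x - + x u)
    lhs = trans (pos-* (∑ x′) (∑ x′)) (sym (cong₂ _*_ ∑x ∑x))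
    rhs : + (count p′ ℕ.* ∑ (λ i → x′ i ℕ.* x′ i)) ≡ (+ count p - 1ℤ) * (+ ∑ (λ i → x i ℕ.* x i) - + x u * + x u)
    rhs = trans (pos-* (count p′) _) (sym (cong₂ _*_ count′ ∑x²))

  variance-bound : ∀ N K Q D → (K - D) * (K - D) ≤ (N - 1ℤ) * (Q - D * D) →
    Q + K * K - + 2 * D * K ≤ N * (Q - D * D)
  variance-bound N K Q D cs = begin
    Q + K * K - + 2 * D * K                ≡⟨ complete-square Q K D ⟩
    (K - D) * (K - D) + (Q - D * D)        ≤⟨ +-monoˡ-≤ (Q - D * D) cs ⟩
    (N - 1ℤ) * (Q - D * D) + (Q - D * D)   ≡⟨ collect N (Q - D * D) ⟩
    N * (Q - D * D)                        ∎
    where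
    open ≤-Reasoning
    complete-square : ∀ Q K D → Q + K * K - + 2 * D * K ≡ (K - D) * (K - D) + (Q - D * D)
    complete-square = solve-∀
    collect : ∀ N V → (N - 1ℤ) * V + V ≡ N * V
    collect = solve-∀

module HalfParity where

  open import Data.Nat using (zero; suc; _+_; _%_; parity)
  open import Data.Nat.DivMod using ([m+n]%n≡m%n)
  open import Data.Nat.Tactic.RingSolver using (solve-∀)
  open import Data.Parity.Base using (0ℙ; 1ℙ)
  open import Relation.Binary.PropositionalEquality

  double-%4-step : ∀ h → (suc (suc h) + suc (suc h)) % 4 ≡ (h + h) % 4
  double-%4-step h = trans (cong (_% 4) (shift h)) ([m+n]%n≡m%n (h + h) 4)
    where
    shift : ∀ h → suc (suc h) + suc (suc h) ≡ h + h + 4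
    shift = solve-∀

  even-half : ∀ h → (h + h) % 4 ≡ 0 → parity h ≡ 0ℙ
  even-half zero          _  = refl
  even-half (suc zero)    ()
  even-half (suc (suc h)) eq = even-half h (trans (sym (double-%4-step h)) eq)

  odd-half : ∀ h → (h + h) % 4 ≡ 2 → parity h ≡ 1ℙ
  odd-half zero          ()
  odd-half (suc zero)    _  = refl
  odd-half (suc (suc h)) eq = odd-half h (trans (sym (double-%4-step h)) eq)

module TreeWalks where

  open import Data.Nat using (ℕ; zero; suc; _+_; _*_; _∸_; _<_; s≤s; parity)
  open import Data.Nat.Properties using (m<n⇒m<1+n; n<1+n; *-zeroʳ)
  open import Data.Nat.Tactic.RingSolver using (solve-∀)
  open import Data.Parity.Properties using (suc-homo-⁻¹; ⁻¹-injective)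
  open import Function using (_∘_)
  open import Relation.Binary.PropositionalEquality
  open import Relation.Nullary using (contradiction)
  open import Defs using (treeWalks)
  open Sums

  treeWalks-vanish : ∀ k {ℓ d} → ℓ < d → treeWalks k ℓ d ≡ 0
  treeWalks-vanish k {zero}  {suc d} _         = refl
  treeWalks-vanish k {suc ℓ} {suc d} (s≤s ℓ<d) = cong₂ _+_ (treeWalks-vanish k ℓ<d)
    (trans (cong ((k ∸ 1) *_) (treeWalks-vanish k (m<n⇒m<1+n (m<n⇒m<1+n ℓ<d)))) (*-zeroʳ (k ∸ 1)))

  treeWalks-diag : ∀ k ℓ → treeWalks k ℓ ℓ ≡ 1
  treeWalks-diag k zero    = refl
  treeWalks-diag k (suc ℓ) = cong₂ _+_ (treeWalks-diag k ℓ)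
    (trans (cong ((k ∸ 1) *_) (treeWalks-vanish k (m<n⇒m<1+n (n<1+n ℓ)))) (*-zeroʳ (k ∸ 1)))

  parity-suc-cong : ∀ m n → parity m ≡ parity n → parity (suc m) ≡ parity (suc n)
  parity-suc-cong m n eq = ⁻¹-injective (trans (suc-homo-⁻¹ m) (trans eq (sym (suc-homo-⁻¹ n))))

  treeWalks-parity : ∀ k ℓ d → parity ℓ ≢ parity d → treeWalks k ℓ d ≡ 0
  treeWalks-parity k zero    zero    ≢ = contradiction refl ≢
  treeWalks-parity k zero    (suc d) ≢ = refl
  treeWalks-parity k (suc ℓ) zero    ≢ =
    trans (cong (k *_) (treeWalks-parity k ℓ 1 (≢ ∘ parity-suc-cong ℓ 1))) (*-zeroʳ k)
  treeWalks-parity k (suc ℓ) (suc d) ≢ = cong₂ _+_ (treeWalks-parity k ℓ d (≢ ∘ parity-suc-cong ℓ d))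
    (trans (cong ((k ∸ 1) *_) (treeWalks-parity k ℓ (suc (suc d)) (≢ ∘ parity-suc-cong ℓ d))) (*-zeroʳ (k ∸ 1)))

  ∑<-treeWalks-suc : ∀ k ℓ (N N′ : ℕ → ℕ) →
    N′ 0 ≡ N 1 → N′ 1 ≡ N 2 + k * N 0 → (∀ e → N′ (2 + e) ≡ N (3 + e) + (k ∸ 1) * N (1 + e)) →
    ∑< (2 + ℓ) (λ d → treeWalks k ℓ d * N′ d) ≡ ∑< (3 + ℓ) (λ d → treeWalks k (suc ℓ) d * N d)
  ∑<-treeWalks-suc k ℓ N N′ N′₀ N′₁ N′₂₊ = begin
    t 0 * N′ 0 + (t 1 * N′ 1 + ∑< ℓ (λ e → t (2 + e) * N′ (2 + e)))
      ≡⟨ cong₂ (λ x y → t 0 * x + (t 1 * y + ∑< ℓ (λ e → t (2 + e) * N′ (2 + e)))) N′₀ N′₁ ⟩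
    t 0 * N 1 + (t 1 * (N 2 + k * N 0) + ∑< ℓ (λ e → t (2 + e) * N′ (2 + e)))
      ≡⟨ cong (λ x → t 0 * N 1 + (t 1 * (N 2 + k * N 0) + x)) tail ⟩
    t 0 * N 1 + (t 1 * (N 2 + k * N 0) + (S₁ + κ * S₂))
      ≡⟨ regroup (t 0) (t 1) (N 0) (N 1) (N 2) k κ S₁ S₂ ⟩
    k * t 1 * N 0 + (∑< (2 + ℓ) (λ d → t d * N (1 + d)) + κ * S₂)
      ≡⟨ cong (λ x → k * t 1 * N 0 + (∑< (2 + ℓ) (λ d → t d * N (1 + d)) + κ * x))
              (sym (∑<-drop-zeros ℓ g g-ℓ≡0 g-1+ℓ≡0)) ⟩
    k * t 1 * N 0 + (∑< (2 + ℓ) (λ d → t d * N (1 + d)) + κ * ∑< (2 + ℓ) g)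
      ≡⟨ cong (k * t 1 * N 0 +_) combine ⟩
    k * t 1 * N 0 + ∑< (2 + ℓ) (λ d → (t d + κ * t (2 + d)) * N (1 + d))
      ∎
    where
    open ≡-Reasoning
    t = treeWalks k ℓ
    κ = k ∸ 1
    g : ℕ → ℕ
    g d = t (2 + d) * N (1 + d)
    S₁ = ∑< ℓ (λ e → t (2 + e) * N (3 + e))
    S₂ = ∑< ℓ g
    g-ℓ≡0 : g ℓ ≡ 0
    g-ℓ≡0 = cong (_* N (1 + ℓ)) (treeWalks-vanish k (m<n⇒m<1+n (n<1+n ℓ)))
    g-1+ℓ≡0 : g (1 + ℓ) ≡ 0
    g-1+ℓ≡0 = cong (_* N (2 + ℓ)) (treeWalks-vanish k (m<n⇒m<1+n (m<n⇒m<1+n (n<1+n ℓ))))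
    spread : ∀ a b c d → a * (b + c * d) ≡ a * b + c * (a * d)
    spread = solve-∀
    tail : ∑< ℓ (λ e → t (2 + e) * N′ (2 + e)) ≡ S₁ + κ * S₂
    tail = begin
      ∑< ℓ (λ e → t (2 + e) * N′ (2 + e))
        ≡⟨ ∑<-cong ℓ (λ e → trans (cong (t (2 + e) *_) (N′₂₊ e)) (spread (t (2 + e)) (N (3 + e)) κ (N (1 + e)))) ⟩
      ∑< ℓ (λ e → t (2 + e) * N (3 + e) + κ * g e)
        ≡⟨ ∑<-distrib-+ ℓ (λ e → t (2 + e) * N (3 + e)) (λ e → κ * g e) ⟩
      S₁ + ∑< ℓ (λ e → κ * g e)
        ≡⟨ cong (S₁ +_) (∑<-*ˡ ℓ κ g) ⟩
      S₁ + κ * S₂ ∎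
    regroup : ∀ t₀ t₁ N₀ N₁ N₂ k κ S₁ S₂ →
      t₀ * N₁ + (t₁ * (N₂ + k * N₀) + (S₁ + κ * S₂)) ≡ k * t₁ * N₀ + ((t₀ * N₁ + (t₁ * N₂ + S₁)) + κ * S₂)
    regroup = solve-∀
    collect : ∀ a b c d → a * b + c * (d * b) ≡ (a + c * d) * b
    collect = solve-∀
    combine : ∑< (2 + ℓ) (λ d → t d * N (1 + d)) + κ * ∑< (2 + ℓ) g
            ≡ ∑< (2 + ℓ) (λ d → (t d + κ * t (2 + d)) * N (1 + d))
    combine = begin
      ∑< (2 + ℓ) (λ d → t d * N (1 + d)) + κ * ∑< (2 + ℓ) g
        ≡⟨ cong (∑< (2 + ℓ) (λ d → t d * N (1 + d)) +_) (sym (∑<-*ˡ (2 + ℓ) κ g)) ⟩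
      ∑< (2 + ℓ) (λ d → t d * N (1 + d)) + ∑< (2 + ℓ) (λ d → κ * g d)
        ≡⟨ sym (∑<-distrib-+ (2 + ℓ) (λ d → t d * N (1 + d)) (λ d → κ * g d)) ⟩
      ∑< (2 + ℓ) (λ d → t d * N (1 + d) + κ * g d)
        ≡⟨ ∑<-cong (2 + ℓ) (λ d → collect (t d) (N (1 + d)) κ (t (2 + d))) ⟩
      ∑< (2 + ℓ) (λ d → (t d + κ * t (2 + d)) * N (1 + d)) ∎

module Walks {n} (G : Graph n) {k} (regular : Regular G k) where

  open import Data.Bool using (Bool; true; false)
  open import Data.Bool.Properties using (¬-not)
  open import Data.Fin using (Fin)
  open import Data.List using (allFin)
  open import Data.Nat using (ℕ; zero; suc; _+_; _*_; _^_; parity)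
  open import Data.Nat.Properties using (+-identityʳ; *-identityʳ; *-zeroʳ; *-comm; *-assoc; +-comm)
  open import Data.Parity.Base using (0ℙ; 1ℙ; _⁻¹)
  open import Data.Parity.Properties using (suc-homo-⁻¹)
  open import Function using (id; _∘_)
  open import Relation.Binary.PropositionalEquality
  open import Defs using (adj)
  open Sums

  A : Fin n → Fin n → ℕ
  A u v = ⟦ adj G u v ⟧

  A-sym : ∀ u v → A u v ≡ A v u
  A-sym u v = cong ⟦_⟧ (Graph.sym G u v)

  A-idem : ∀ u v → A u v * A v u ≡ A u v
  A-idem u v with adj G u v in uv
  ... | true  = trans (+-identityʳ _) (cong ⟦_⟧ (trans (sym (Graph.sym G u v)) uv))
  ... | false = refl

  ∑-A : ∀ u → ∑ (A u) ≡ k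
  ∑-A u = trans (sym (trans (length-filterᵇ (adj G u) (allFin n)) (sum-map-tabulate (A u) id))) (regular u)

  ∑-A-cong : ∀ {u} {f f′ : Fin n → ℕ} → (∀ w → adj G u w ≡ true → f w ≡ f′ w) →
    ∑ (λ w → A u w * f w) ≡ ∑ (λ w → A u w * f′ w)
  ∑-A-cong {u} {f} {f′} f≡f′ = sum-cong-≗ term
    where
    term : ∀ w → A u w * f w ≡ A u w * f′ w
    term w with adj G u w in uw
    ... | true  = cong (_+ 0) (f≡f′ w uw)
    ... | false = refl

  ∑-A-zero : ∀ {u} (f : Fin n → ℕ) → (∀ w → adj G u w ≡ true → f w ≡ 0) → ∑ (λ w → A u w * f w) ≡ 0
  ∑-A-zero {u} f f≡0 = trans (∑-A-cong f≡0) (∑-zero (λ w → A u w * 0) (*-zeroʳ ∘ A u))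

  walks : ℕ → Fin n → Fin n → ℕ
  walks zero    u v = δ u v
  walks (suc ℓ) u v = ∑ λ w → A u w * walks ℓ w v

  ∑-walks : ∀ ℓ u → ∑ (walks ℓ u) ≡ k ^ ℓ
  ∑-walks zero    u = trans (sum-cong-≗ λ v → sym (*-identityʳ (δ u v))) (∑-δ u (λ _ → 1))
  ∑-walks (suc ℓ) u = begin
    ∑ (λ v → ∑ λ w → A u w * walks ℓ w v)   ≡⟨ ∑-comm (λ v w → A u w * walks ℓ w v) ⟩
    ∑ (λ w → ∑ λ v → A u w * walks ℓ w v)   ≡⟨ sum-cong-≗ (λ w → sym (*-distribˡ-sum (A u w) (walks ℓ w))) ⟩
    ∑ (λ w → A u w * ∑ (walks ℓ w))         ≡⟨ sum-cong-≗ (λ w → cong (A u w *_) (∑-walks ℓ w)) ⟩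
    ∑ (λ w → A u w * k ^ ℓ)                 ≡⟨ sym (*-distribʳ-sum (k ^ ℓ) (A u)) ⟩
    ∑ (A u) * k ^ ℓ                         ≡⟨ cong (_* k ^ ℓ) (∑-A u) ⟩
    k ^ suc ℓ                               ∎
    where open ≡-Reasoning

  walks-+ : ∀ ℓ m u v → walks (ℓ + m) u v ≡ ∑ λ w → walks ℓ u w * walks m w v
  walks-+ zero    m u v = sym (∑-δ u (λ w → walks m w v))
  walks-+ (suc ℓ) m u v = begin
    ∑ (λ x → A u x * walks (ℓ + m) x v)
      ≡⟨ sum-cong-≗ (λ x → cong (A u x *_) (walks-+ ℓ m x v)) ⟩
    ∑ (λ x → A u x * ∑ λ w → walks ℓ x w * walks m w v)
      ≡⟨ sum-cong-≗ (λ x → *-distribˡ-sum (A u x) (λ w → walks ℓ x w * walks m w v)) ⟩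
    ∑ (λ x → ∑ λ w → A u x * (walks ℓ x w * walks m w v))
      ≡⟨ ∑-comm (λ x w → A u x * (walks ℓ x w * walks m w v)) ⟩
    ∑ (λ w → ∑ λ x → A u x * (walks ℓ x w * walks m w v))
      ≡⟨ sum-cong-≗ (λ w → sum-cong-≗ λ x → sym (*-assoc (A u x) (walks ℓ x w) (walks m w v))) ⟩
    ∑ (λ w → ∑ λ x → A u x * walks ℓ x w * walks m w v)
      ≡⟨ sum-cong-≗ (λ w → sym (*-distribʳ-sum (walks m w v) (λ x → A u x * walks ℓ x w))) ⟩
    ∑ (λ w → walks (suc ℓ) u w * walks m w v) ∎
    where open ≡-Reasoning

  walks-sym : ∀ ℓ u v → walks ℓ u v ≡ walks ℓ v u
  walks-sym zero    u v = δ-sym u v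
  walks-sym (suc ℓ) u v = begin
    walks (suc ℓ) u v                      ≡⟨ cong (λ m → walks m u v) (+-comm 1 ℓ) ⟩
    walks (ℓ + 1) u v                      ≡⟨ walks-+ ℓ 1 u v ⟩
    ∑ (λ w → walks ℓ u w * walks 1 w v)    ≡⟨ sum-cong-≗ (λ w → trans (cong₂ _*_ (walks-sym ℓ u w) (walks-1 w))
                                                                      (*-comm (walks ℓ w u) (A v w))) ⟩
    walks (suc ℓ) v u                      ∎
    where
    open ≡-Reasoning
    walks-1 : ∀ w → walks 1 w v ≡ A v w
    walks-1 w = trans (sum-cong-≗ λ x → trans (*-comm (A w x) (δ x v)) (cong (_* A w x) (δ-sym x v)))
                      (trans (∑-δ v (A w)) (A-sym w v))

  ∑-walks² : ∀ ℓ u → ∑ (λ v → walks ℓ u v * walks ℓ u v) ≡ walks (ℓ + ℓ) u u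
  ∑-walks² ℓ u = sym (trans (walks-+ ℓ ℓ u u) (sum-cong-≗ λ v → cong (walks ℓ u v *_) (walks-sym ℓ v u)))

  module Colouring (colour : Fin n → Bool) (proper : ∀ u v → adj G u v ≡ true → colour u ≢ colour v) where

    walks-even-across : ∀ ℓ {u v} → parity ℓ ≡ 0ℙ → colour u ≢ colour v → walks ℓ u v ≡ 0
    walks-odd-within  : ∀ ℓ {u v} → parity ℓ ≡ 1ℙ → colour u ≡ colour v → walks ℓ u v ≡ 0

    walks-even-across zero    {u} {v} _    u≢v = δ-≢ {i = u} {v} λ { refl → u≢v refl }
    walks-even-across (suc ℓ) {u} {v} even u≢v = ∑-A-zero (λ w → walks ℓ w v) λ w uw →
      walks-odd-within ℓ (trans (sym (suc-homo-⁻¹ ℓ)) (cong _⁻¹ even))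
        (trans (¬-not (≢-sym (proper u w uw))) (sym (¬-not (≢-sym u≢v))))
    walks-odd-within  (suc ℓ) {u} {v} odd  u≡v = ∑-A-zero (λ w → walks ℓ w v) λ w uw →
      walks-even-across ℓ (trans (sym (suc-homo-⁻¹ ℓ)) (cong _⁻¹ odd))
        (λ w≡v → proper u w uw (trans u≡v (sym w≡v)))

module NonBacktracking {n} (G : Graph n) {k} (regular : Regular G k) where

  open import Data.Bool using (true; false)
  open import Data.Fin using (Fin; toℕ)
  open import Data.Nat using (ℕ; zero; suc; _+_; _*_; _∸_)
  open import Data.Nat.Properties using (+-identityʳ; *-comm; *-assoc; *-distribˡ-+; m+n∸n≡m)
  open import Data.Nat.Tactic.RingSolver using (solve-∀)
  open import Relation.Binary.PropositionalEquality
  open import Defs using (adj; treeWalks)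
  open Sums
  open TreeWalks
  open Walks G regular

  -- nbWalksAfter d p u v counts the non-backtracking walks of length d from u to v
  -- whose first step does not go back to p, the vertex u was entered from.
  nbWalksAfter : ℕ → Fin n → Fin n → Fin n → ℕ
  nbWalksAfter zero    p u v = δ u v
  nbWalksAfter (suc d) p u v = ∑ λ w → A u w * (δᶜ p w * nbWalksAfter d u w v)

  nbWalks : ℕ → Fin n → Fin n → ℕ
  nbWalks zero    u v = δ u v
  nbWalks (suc d) u v = ∑ λ w → A u w * nbWalksAfter d u w v

  bounceWalks : ℕ → Fin n → Fin n → ℕ
  bounceWalks d u v = ∑ λ w → A u w * nbWalksAfter d w u v

  A-nbWalks-suc : ∀ d u v → ∑ (λ w → A u w * nbWalks (suc d) w v) ≡ nbWalks (2 + d) u v + bounceWalks d u v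
  A-nbWalks-suc d u v =
    trans (sum-cong-≗ split) (∑-distrib-+ (λ w → A u w * nbWalksAfter (suc d) u w v) (λ w → A u w * nbWalksAfter d w u v))
    where
    swap : ∀ a b c → a * (b * c) ≡ b * (a * c)
    swap = solve-∀
    split : ∀ w → A u w * nbWalks (suc d) w v ≡ A u w * nbWalksAfter (suc d) u w v + A u w * nbWalksAfter d w u v
    split w = begin
      A u w * ∑ (λ x → A w x * nbWalksAfter d w x v)
        ≡⟨ cong (A u w *_) (∑-δᶜ u (λ x → A w x * nbWalksAfter d w x v)) ⟩
      A u w * (∑ (λ x → δᶜ u x * (A w x * nbWalksAfter d w x v)) + A w u * nbWalksAfter d w u v)
        ≡⟨ cong (λ s → A u w * (s + A w u * nbWalksAfter d w u v)) (sum-cong-≗ λ x → swap (δᶜ u x) (A w x) _) ⟩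
      A u w * (nbWalksAfter (suc d) u w v + A w u * nbWalksAfter d w u v)
        ≡⟨ *-distribˡ-+ (A u w) _ _ ⟩
      A u w * nbWalksAfter (suc d) u w v + A u w * (A w u * nbWalksAfter d w u v)
        ≡⟨ cong (A u w * nbWalksAfter (suc d) u w v +_)
             (trans (sym (*-assoc (A u w) (A w u) _)) (cong (_* nbWalksAfter d w u v) (A-idem u w))) ⟩
      A u w * nbWalksAfter (suc d) u w v + A u w * nbWalksAfter d w u v ∎
      where open ≡-Reasoning

  bounceWalks-zero : ∀ u v → bounceWalks 0 u v ≡ k * nbWalks 0 u v
  bounceWalks-zero u v = trans (sym (*-distribʳ-sum (δ u v) (A u))) (cong (_* δ u v) (∑-A u))

  other-neighbours : ∀ u x → A u x * ∑ (λ w → A u w * δᶜ w x) ≡ A u x * (k ∸ 1)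
  other-neighbours u x with adj G u x in ux
  ... | false = refl
  ... | true  = cong (_+ 0) (trans (sym (m+n∸n≡m others 1)) (cong (_∸ 1) others+1≡k))
    where
    others = ∑ (λ w → A u w * δᶜ w x)
    others+1≡k : others + 1 ≡ k
    others+1≡k = begin
      others + 1                         ≡⟨ cong₂ _+_ (sum-cong-≗ λ w → trans (cong (A u w *_) (δᶜ-sym w x))
                                                                                       (*-comm (A u w) (δᶜ x w)))
                                                       (cong ⟦_⟧ (sym ux)) ⟩
      ∑ (λ w → δᶜ x w * A u w) + A u x   ≡⟨ sym (∑-δᶜ x (A u)) ⟩
      ∑ (A u)                            ≡⟨ ∑-A u ⟩
      k                                  ∎
      where open ≡-Reasoning

  bounceWalks-suc : ∀ e u v → bounceWalks (suc e) u v ≡ (k ∸ 1) * nbWalks (suc e) u v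
  bounceWalks-suc e u v = begin
    ∑ (λ w → A u w * ∑ λ x → A u x * (δᶜ w x * N x))
      ≡⟨ sum-cong-≗ (λ w → *-distribˡ-sum (A u w) (λ x → A u x * (δᶜ w x * N x))) ⟩
    ∑ (λ w → ∑ λ x → A u w * (A u x * (δᶜ w x * N x)))
      ≡⟨ ∑-comm (λ w x → A u w * (A u x * (δᶜ w x * N x))) ⟩
    ∑ (λ x → ∑ λ w → A u w * (A u x * (δᶜ w x * N x)))
      ≡⟨ sum-cong-≗ (λ x → trans (sum-cong-≗ λ w → rearrange (A u w) (A u x) (δᶜ w x) (N x)) (factor x)) ⟩
    ∑ (λ x → N x * (A u x * ∑ λ w → A u w * δᶜ w x))
      ≡⟨ sum-cong-≗ (λ x → trans (cong (N x *_) (other-neighbours u x)) (rearrange′ (N x) (A u x) (k ∸ 1))) ⟩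
    ∑ (λ x → (k ∸ 1) * (A u x * N x))
      ≡⟨ sym (*-distribˡ-sum (k ∸ 1) (λ x → A u x * N x)) ⟩
    (k ∸ 1) * nbWalks (suc e) u v ∎
    where
    open ≡-Reasoning
    N : Fin n → ℕ
    N x = nbWalksAfter e u x v
    rearrange : ∀ a b c d → a * (b * (c * d)) ≡ d * (b * (a * c))
    rearrange = solve-∀
    rearrange′ : ∀ a b c → a * (b * c) ≡ c * (b * a)
    rearrange′ = solve-∀
    factor : ∀ x → ∑ (λ w → N x * (A u x * (A u w * δᶜ w x))) ≡ N x * (A u x * ∑ λ w → A u w * δᶜ w x)
    factor x = sym (trans (cong (N x *_) (*-distribˡ-sum (A u x) (λ w → A u w * δᶜ w x)))
                          (*-distribˡ-sum (N x) (λ w → A u x * (A u w * δᶜ w x))))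

  walks-nbWalks : ∀ ℓ u v → walks ℓ u v ≡ ∑< (2 + ℓ) (λ d → treeWalks k ℓ d * nbWalks d u v)
  walks-nbWalks zero    u v = sym (trans (+-identityʳ _) (+-identityʳ (δ u v)))
  walks-nbWalks (suc ℓ) u v = begin
    ∑ (λ w → A u w * walks ℓ w v)
      ≡⟨ sum-cong-≗ (λ w → trans (cong (A u w *_) (walks-nbWalks ℓ w v))
                                 (sym (∑<-*ˡ (2 + ℓ) (A u w) (λ d → t d * N[ w ] d)))) ⟩
    ∑ (λ w → ∑< (2 + ℓ) λ d → A u w * (t d * N[ w ] d))
      ≡⟨ ∑-comm {n} {2 + ℓ} (λ w d → A u w * (t (toℕ d) * N[ w ] (toℕ d))) ⟩
    ∑< (2 + ℓ) (λ d → ∑ λ w → A u w * (t d * N[ w ] d))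
      ≡⟨ ∑<-cong (2 + ℓ) (λ d → trans (sum-cong-≗ λ w → swap (A u w) (t d) _)
                                      (sym (*-distribˡ-sum (t d) (λ w → A u w * N[ w ] d)))) ⟩
    ∑< (2 + ℓ) (λ d → t d * ∑ λ w → A u w * N[ w ] d)
      ≡⟨ ∑<-treeWalks-suc k ℓ N[ u ] (λ d → ∑ λ w → A u w * N[ w ] d) refl
           (trans (A-nbWalks-suc 0 u v) (cong (N[ u ] 2 +_) (bounceWalks-zero u v)))
           (λ e → trans (A-nbWalks-suc (suc e) u v) (cong (N[ u ] (3 + e) +_) (bounceWalks-suc e u v))) ⟩
    ∑< (3 + ℓ) (λ d → treeWalks k (suc ℓ) d * nbWalks d u v) ∎
    where
    open ≡-Reasoning
    t = treeWalks k ℓ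
    N[_] : Fin n → ℕ → ℕ
    N[ w ] d = nbWalks d w v
    swap : ∀ a b c → a * (b * c) ≡ b * (a * c)
    swap = solve-∀

module Paths {n} (G : Graph n) where

  open import Data.Bool using (Bool; true; false; not; _∧_; _∨_)
  open import Data.Bool.Properties
    using (∧-conicalˡ; ∧-conicalʳ; ∨-conicalˡ; ∨-conicalʳ; ∨-zeroʳ; ¬-not; not-injective; T-≡)
  open import Data.Bool.ListAction using (any)
  open import Data.Fin using (Fin; _≟_)
  open import Data.List using (List; []; _∷_; _++_; length)
  open import Data.List.Properties using (++-assoc; length-++)
  open import Data.Nat using (suc; _≤_; _≤ᵇ_; s≤s)
  open import Data.Nat.Properties using (≤⇒≤ᵇ; ≤-refl; m≤n⇒m≤1+n; m≤n+m; +-comm)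
  open import Data.Product using (Σ-syntax; _×_; _,_; proj₁; proj₂)
  open import Function using (_∘_)
  open import Function.Bundles using (Equivalence)
  open import Relation.Binary.PropositionalEquality
  open import Relation.Nullary using (contradiction)
  open import Relation.Nullary.Decidable using (⌊_⌋; yes; no)
  open import Defs using (adj; irrefl; allDistinct; pathᵇ; lastOr; closeᵇ; isCycleᵇ)

  _∈ᵇ_ : Fin n → List (Fin n) → Bool
  y ∈ᵇ xs = any (λ x → ⌊ y ≟ x ⌋) xs

  IsPath : List (Fin n) → Set
  IsPath xs = allDistinct G xs ≡ true × pathᵇ G xs ≡ true

  true≢false : true ≢ false
  true≢false ()

  ≤ᵇ-true : ∀ {m m′} → m ≤ m′ → (m ≤ᵇ m′) ≡ true
  ≤ᵇ-true = Equivalence.to T-≡ ∘ ≤⇒≤ᵇ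

  ≟-true : ∀ {x y : Fin n} → x ≡ y → ⌊ x ≟ y ⌋ ≡ true
  ≟-true {x} {y} x≡y with x ≟ y
  ... | yes _   = refl
  ... | no x≢y  = contradiction x≡y x≢y

  ≟-false : ∀ {x y : Fin n} → x ≢ y → ⌊ x ≟ y ⌋ ≡ false
  ≟-false {x} {y} x≢y with x ≟ y
  ... | yes x≡y = contradiction x≡y x≢y
  ... | no _    = refl

  ≟-false⁻ : ∀ {x y : Fin n} → ⌊ x ≟ y ⌋ ≡ false → x ≢ y
  ≟-false⁻ x≟y x≡y = true≢false (trans (sym (≟-true x≡y)) x≟y)

  adjacent-≢ : ∀ {v w} → adj G v w ≡ true → v ≢ w
  adjacent-≢ {v} vw refl = true≢false (trans (sym vw) (irrefl G v))

  ∈ᵇ-here : ∀ y ys → y ∈ᵇ (y ∷ ys) ≡ true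
  ∈ᵇ-here y ys = cong (_∨ y ∈ᵇ ys) (≟-true refl)

  ∈ᵇ-++⁺ˡ : ∀ {y} xs ys → y ∈ᵇ xs ≡ true → y ∈ᵇ (xs ++ ys) ≡ true
  ∈ᵇ-++⁺ˡ {y} (x ∷ xs) ys y∈ with ⌊ y ≟ x ⌋
  ... | true  = refl
  ... | false = ∈ᵇ-++⁺ˡ xs ys y∈

  ∈ᵇ-++⁺ʳ : ∀ {y} xs ys → y ∈ᵇ ys ≡ true → y ∈ᵇ (xs ++ ys) ≡ true
  ∈ᵇ-++⁺ʳ     []       ys y∈ = y∈
  ∈ᵇ-++⁺ʳ {y} (x ∷ xs) ys y∈ = trans (cong (⌊ y ≟ x ⌋ ∨_) (∈ᵇ-++⁺ʳ xs ys y∈)) (∨-zeroʳ _)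

  ∈ᵇ-++⁻ˡ : ∀ {y} xs ys → y ∈ᵇ (xs ++ ys) ≡ false → y ∈ᵇ xs ≡ false
  ∈ᵇ-++⁻ˡ xs ys y∉ = ¬-not λ y∈ → true≢false (trans (sym (∈ᵇ-++⁺ˡ xs ys y∈)) y∉)

  ∈ᵇ-∉-≢ : ∀ {x y} xs → y ∈ᵇ xs ≡ true → x ∈ᵇ xs ≡ false → y ≢ x
  ∈ᵇ-∉-≢ xs y∈ x∉ refl = true≢false (trans (sym y∈) x∉)

  ∉ᵇ-snoc : ∀ {y w} xs → y ∈ᵇ xs ≡ false → y ≢ w → y ∈ᵇ (xs ++ w ∷ []) ≡ false
  ∉ᵇ-snoc         []       _  y≢w = cong (_∨ false) (≟-false y≢w)
  ∉ᵇ-snoc {y} (x ∷ xs) y∉ y≢w =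
    cong₂ _∨_ (∨-conicalˡ ⌊ y ≟ x ⌋ _ y∉) (∉ᵇ-snoc xs (∨-conicalʳ ⌊ y ≟ x ⌋ _ y∉) y≢w)

  allDistinct-snoc⁺ : ∀ xs {w} → allDistinct G xs ≡ true → w ∈ᵇ xs ≡ false → allDistinct G (xs ++ w ∷ []) ≡ true
  allDistinct-snoc⁺ []       _    _  = refl
  allDistinct-snoc⁺ (x ∷ xs) {w} dist w∉ =
    cong₂ _∧_ (cong not (∉ᵇ-snoc xs x∉xs (≢-sym (≟-false⁻ (∨-conicalˡ ⌊ w ≟ x ⌋ _ w∉)))))
              (allDistinct-snoc⁺ xs (∧-conicalʳ _ _ dist) (∨-conicalʳ ⌊ w ≟ x ⌋ _ w∉))
    where
    x∉xs : x ∈ᵇ xs ≡ false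
    x∉xs = not-injective (∧-conicalˡ _ _ dist)

  allDistinct-snoc⁻ : ∀ xs {w} → allDistinct G (xs ++ w ∷ []) ≡ true → w ∈ᵇ xs ≡ false
  allDistinct-snoc⁻ []           _    = refl
  allDistinct-snoc⁻ (x ∷ xs) {w} dist = cong₂ _∨_ (≟-false w≢x) (allDistinct-snoc⁻ xs (∧-conicalʳ _ _ dist))
    where
    w≢x : w ≢ x
    w≢x refl = true≢false (trans (sym (∈ᵇ-++⁺ʳ xs (w ∷ []) (∈ᵇ-here w []))) (not-injective (∧-conicalˡ _ _ dist)))

  allDistinct-++⁻ˡ : ∀ xs ys → allDistinct G (xs ++ ys) ≡ true → allDistinct G xs ≡ true
  allDistinct-++⁻ˡ []       ys _    = refl
  allDistinct-++⁻ˡ (x ∷ xs) ys dist = cong₂ _∧_ (cong not (∈ᵇ-++⁻ˡ xs ys (not-injective (∧-conicalˡ _ _ dist))))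
                                               (allDistinct-++⁻ˡ xs ys (∧-conicalʳ _ _ dist))

  pathᵇ-∷⁻ : ∀ x xs → pathᵇ G (x ∷ xs) ≡ true → pathᵇ G xs ≡ true
  pathᵇ-∷⁻ x []       _    = refl
  pathᵇ-∷⁻ x (y ∷ xs) path = ∧-conicalʳ (adj G x y) _ path

  pathᵇ-++⁻ˡ : ∀ xs ys → pathᵇ G (xs ++ ys) ≡ true → pathᵇ G xs ≡ true
  pathᵇ-++⁻ˡ []           ys _    = refl
  pathᵇ-++⁻ˡ (x ∷ [])     ys _    = refl
  pathᵇ-++⁻ˡ (x ∷ y ∷ xs) ys path =
    cong₂ _∧_ (∧-conicalˡ (adj G x y) _ path) (pathᵇ-++⁻ˡ (y ∷ xs) ys (∧-conicalʳ (adj G x y) _ path))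

  pathᵇ-++⁻ʳ : ∀ xs ys → pathᵇ G (xs ++ ys) ≡ true → pathᵇ G ys ≡ true
  pathᵇ-++⁻ʳ []       ys path = path
  pathᵇ-++⁻ʳ (x ∷ xs) ys path = pathᵇ-++⁻ʳ xs ys (pathᵇ-∷⁻ x (xs ++ ys) path)

  pathᵇ-snoc⁺ : ∀ xs {u w} → pathᵇ G (xs ++ u ∷ []) ≡ true → adj G u w ≡ true → pathᵇ G (xs ++ u ∷ w ∷ []) ≡ true
  pathᵇ-snoc⁺ []               _    uw = cong (_∧ true) uw
  pathᵇ-snoc⁺ (x ∷ [])     {u} path uw = cong₂ _∧_ (∧-conicalˡ (adj G x u) true path) (cong (_∧ true) uw)
  pathᵇ-snoc⁺ (x ∷ y ∷ xs)     path uw =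
    cong₂ _∧_ (∧-conicalˡ (adj G x y) _ path) (pathᵇ-snoc⁺ (y ∷ xs) (∧-conicalʳ (adj G x y) _ path) uw)

  lastOr-snoc : ∀ x xs u → lastOr G x (xs ++ u ∷ []) ≡ u
  lastOr-snoc x []       u = refl
  lastOr-snoc x (y ∷ xs) u = lastOr-snoc y xs u

  edge-IsPath : ∀ {v w} → adj G v w ≡ true → IsPath (v ∷ w ∷ [])
  edge-IsPath vw = cong (λ b → not (b ∨ false) ∧ true) (≟-false (adjacent-≢ vw)) , cong (_∧ true) vw

  cycle-IsPath : ∀ xs ys → isCycleᵇ G (xs ++ ys) ≡ true → IsPath xs
  cycle-IsPath xs ys cyc =
    allDistinct-++⁻ˡ xs ys (∧-conicalˡ (allDistinct G zs) _ rest) ,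
    pathᵇ-++⁻ˡ xs ys (∧-conicalˡ (pathᵇ G zs) _ (∧-conicalʳ (allDistinct G zs) _ rest))
    where
    zs = xs ++ ys
    rest = ∧-conicalʳ (3 ≤ᵇ length zs) _ cyc

  extend-assoc : ∀ q (p u w : Fin n) → (q ++ p ∷ u ∷ []) ++ w ∷ [] ≡ (q ++ p ∷ []) ++ u ∷ w ∷ []
  extend-assoc q p u w = trans (++-assoc q (p ∷ u ∷ []) (w ∷ [])) (sym (++-assoc q (p ∷ []) (u ∷ w ∷ [])))

  length-extend : ∀ q (p u w : Fin n) → length ((q ++ p ∷ []) ++ u ∷ w ∷ []) ≡ suc (length (q ++ p ∷ u ∷ []))
  length-extend q p u w = trans (cong length (sym (extend-assoc q p u w))) (trans (length-++ (q ++ p ∷ u ∷ [])) (+-comm _ 1))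

  IsPath-extend : ∀ q {p u w} → IsPath (q ++ p ∷ u ∷ []) → adj G u w ≡ true → w ∈ᵇ (q ++ p ∷ u ∷ []) ≡ false →
    IsPath ((q ++ p ∷ []) ++ u ∷ w ∷ [])
  IsPath-extend q {p} {u} {w} (dist , path) uw w∉ =
    subst (λ xs → allDistinct G xs ≡ true) (extend-assoc q p u w) (allDistinct-snoc⁺ (q ++ p ∷ u ∷ []) dist w∉) ,
    pathᵇ-snoc⁺ (q ++ p ∷ []) (subst (λ xs → pathᵇ G xs ≡ true) (sym (++-assoc q (p ∷ []) (u ∷ []))) path) uw

  isCycleᵇ-closing : ∀ q {p u x rest} → q ++ p ∷ u ∷ [] ≡ x ∷ rest → IsPath (q ++ p ∷ u ∷ []) →
    3 ≤ length (q ++ p ∷ u ∷ []) → isCycleᵇ G (q ++ p ∷ u ∷ []) ≡ adj G u x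
  isCycleᵇ-closing q {p} {u} {x} {rest} eq (dist , path) long =
    cong₂ _∧_ (≤ᵇ-true long) (cong₂ _∧_ dist (cong₂ _∧_ path closes))
    where
    last : ∀ xs → x ∷ rest ≡ xs ++ u ∷ [] → lastOr G x rest ≡ u
    last []       refl = refl
    last (y ∷ xs) refl = lastOr-snoc y xs u
    closes : closeᵇ G (q ++ p ∷ u ∷ []) ≡ adj G u x
    closes = trans (cong (closeᵇ G) eq)
                   (cong (λ z → adj G z x) (last (q ++ p ∷ []) (trans (sym eq) (sym (++-assoc q (p ∷ []) (u ∷ []))))))

  first-≢-penultimate : ∀ q {p u x rest} → q ++ p ∷ u ∷ [] ≡ x ∷ rest → allDistinct G (q ++ p ∷ u ∷ []) ≡ true →
    3 ≤ length (q ++ p ∷ u ∷ []) → p ≢ x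
  first-≢-penultimate []                _    _    (s≤s (s≤s ()))
  first-≢-penultimate (x ∷ q) {p} {u} refl dist _ refl =
    true≢false (trans (sym (∈ᵇ-++⁺ʳ q (p ∷ u ∷ []) (∈ᵇ-here p (u ∷ [])))) (not-injective (∧-conicalˡ _ _ dist)))

  short-cycle : ∀ q p u w → IsPath (q ++ p ∷ u ∷ []) → w ∈ᵇ (q ++ p ∷ u ∷ []) ≡ true → adj G u w ≡ true →
    w ≢ p → Σ[ xs ∈ List (Fin n) ] isCycleᵇ G xs ≡ true × length xs ≤ length (q ++ p ∷ u ∷ [])
  short-cycle [] p u w _ w∈ uw w≢p with w ≟ p | w ≟ u
  ... | yes w≡p | _        = contradiction w≡p w≢p
  ... | no _    | yes refl = contradiction refl (adjacent-≢ uw)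
  short-cycle [] p u w _ () uw w≢p | no _ | no _
  short-cycle (x ∷ q) p u w path w∈ uw w≢p with w ≟ x
  ... | yes refl = (x ∷ q ++ p ∷ u ∷ []) , trans (isCycleᵇ-closing (x ∷ q) refl path long) uw , ≤-refl
    where
    long : 3 ≤ length (x ∷ q ++ p ∷ u ∷ [])
    long = s≤s (subst (2 ≤_) (sym (length-++ q)) (m≤n+m 2 (length q)))
  ... | no _ =
    let tail-path = ∧-conicalʳ _ _ (proj₁ path) , pathᵇ-∷⁻ x (q ++ p ∷ u ∷ []) (proj₂ path)
        xs , cyc , short = short-cycle q p u w tail-path w∈ uw w≢p
    in  xs , cyc , m≤n⇒m≤1+n short

module CycleCompletions {n} (G : Graph n) where

  open import Data.Bool using (Bool; true; false; _∧_)
  open import Data.Bool.Properties using (∧-conicalˡ; ∧-zeroʳ; ∧-identityʳ; ¬-not)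
  open import Data.Fin using (Fin; _≟_)
  open import Data.List using (List; []; _∷_; _++_; length; map; filterᵇ; concatMap; allFin)
  open import Data.List.Properties using (++-assoc; ++-identityʳ; map-cong; map-∘)
  open import Data.Nat using (ℕ; suc)
  open import Data.Nat.ListAction using (sum)
  open import Data.Nat.Properties using (+-identityʳ)
  open import Data.Product using (proj₁; proj₂)
  open import Function using (_∘_; id)
  open import Relation.Binary.PropositionalEquality
  open import Relation.Nullary.Decidable using (⌊_⌋)
  open import Defs using (adj; isCycleᵇ; pathᵇ; allLists; cycleCount; startsWithᵇ)
  open Sums
  open Paths G

  #allLists : (List (Fin n) → Bool) → ℕ → ℕ
  #allLists P m = length (filterᵇ P (allLists G m))

  #allLists-cong : ∀ {P Q} m → (∀ ys → P ys ≡ Q ys) → #allLists P m ≡ #allLists Q m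
  #allLists-cong {P} {Q} m P≡Q = trans (length-filterᵇ P (allLists G m))
    (trans (cong sum (map-cong (cong ⟦_⟧ ∘ P≡Q) (allLists G m))) (sym (length-filterᵇ Q (allLists G m))))

  #allLists-none : ∀ {P} m → (∀ ys → P ys ≡ false) → #allLists P m ≡ 0
  #allLists-none {P} m P≡false = go (allLists G m)
    where
    go : ∀ xss → length (filterᵇ P xss) ≡ 0
    go []         = refl
    go (xs ∷ xss) rewrite P≡false xs = go xss

  #allLists-suc : ∀ P m → #allLists P (suc m) ≡ ∑ λ x → #allLists (P ∘ (x ∷_)) m
  #allLists-suc P m = begin
    length (filterᵇ P (allLists G (suc m)))
      ≡⟨ length-filterᵇ P (allLists G (suc m)) ⟩
    sum (map (⟦_⟧ ∘ P) (concatMap (λ x → map (x ∷_) (allLists G m)) (allFin n)))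
      ≡⟨ sum-map-concatMap (⟦_⟧ ∘ P) (λ x → map (x ∷_) (allLists G m)) (allFin n) ⟩
    sum (map (λ x → sum (map (⟦_⟧ ∘ P) (map (x ∷_) (allLists G m)))) (allFin n))
      ≡⟨ sum-map-tabulate (λ x → sum (map (⟦_⟧ ∘ P) (map (x ∷_) (allLists G m)))) id ⟩
    ∑ (λ x → sum (map (⟦_⟧ ∘ P) (map (x ∷_) (allLists G m))))
      ≡⟨ sum-cong-≗ (λ x → trans (cong sum (sym (map-∘ (allLists G m))))
                                 (sym (length-filterᵇ (P ∘ (x ∷_)) (allLists G m)))) ⟩
    ∑ (λ x → #allLists (P ∘ (x ∷_)) m) ∎
    where open ≡-Reasoning

  completions : ℕ → List (Fin n) → ℕ
  completions d xs = #allLists (λ ys → isCycleᵇ G (xs ++ ys)) d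

  completions-zero : ∀ xs → completions 0 xs ≡ ⟦ isCycleᵇ G xs ⟧
  completions-zero xs = trans (length-filterᵇ (λ ys → isCycleᵇ G (xs ++ ys)) ([] ∷ []))
                              (trans (+-identityʳ _) (cong (⟦_⟧ ∘ isCycleᵇ G) (++-identityʳ xs)))

  completions-suc : ∀ d xs → completions (suc d) xs ≡ ∑ λ w → completions d (xs ++ w ∷ [])
  completions-suc d xs = trans (#allLists-suc (λ ys → isCycleᵇ G (xs ++ ys)) d) (sum-cong-≗ λ w →
    #allLists-cong {λ ys → isCycleᵇ G (xs ++ w ∷ ys)} d λ ys → cong (isCycleᵇ G) (sym (++-assoc xs (w ∷ []) ys)))

  completions-nonadjacent : ∀ d q {p u w} → adj G u w ≡ false → completions d ((q ++ p ∷ u ∷ []) ++ w ∷ []) ≡ 0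
  completions-nonadjacent d q {p} {u} {w} uw = #allLists-none d λ ys → ¬-not λ cyc →
    true≢false (trans (sym (∧-conicalˡ (adj G u w) true (pathᵇ-++⁻ʳ (q ++ p ∷ []) (u ∷ w ∷ [])
      (subst (λ xs → pathᵇ G xs ≡ true) (extend-assoc q p u w)
        (proj₂ (cycle-IsPath ((q ++ p ∷ u ∷ []) ++ w ∷ []) ys cyc)))))) uw)

  completions-revisit : ∀ d xs {w} → w ∈ᵇ xs ≡ true → completions d (xs ++ w ∷ []) ≡ 0
  completions-revisit d xs {w} w∈ = #allLists-none d λ ys → ¬-not λ cyc →
    true≢false (trans (sym w∈) (allDistinct-snoc⁻ xs (proj₁ (cycle-IsPath (xs ++ w ∷ []) ys cyc))))

  cycleCount-completions : ∀ m v w → cycleCount G (suc (suc m)) v w ≡ completions m (v ∷ w ∷ [])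
  cycleCount-completions m v w = begin
    cycleCount G (suc (suc m)) v w
      ≡⟨ #allLists-suc P (suc m) ⟩
    ∑ (λ x → #allLists (P ∘ (x ∷_)) (suc m))
      ≡⟨ ∑-single v _ (λ x x≢v → #allLists-none (suc m) (not-first x≢v)) ⟩
    #allLists (P ∘ (v ∷_)) (suc m)
      ≡⟨ #allLists-suc (P ∘ (v ∷_)) m ⟩
    ∑ (λ y → #allLists (P ∘ (v ∷_) ∘ (y ∷_)) m)
      ≡⟨ ∑-single w _ (λ y y≢w → #allLists-none m (not-second y≢w)) ⟩
    #allLists (P ∘ (v ∷_) ∘ (w ∷_)) m
      ≡⟨ #allLists-cong m (λ zs → cong₂ (λ a b → isCycleᵇ G (v ∷ w ∷ zs) ∧ (a ∧ b))
                                        (≟-true {v} refl) (≟-true {w} refl)) ⟩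
    #allLists (λ zs → isCycleᵇ G (v ∷ w ∷ zs) ∧ true) m
      ≡⟨ #allLists-cong m (λ zs → ∧-identityʳ _) ⟩
    completions m (v ∷ w ∷ []) ∎
    where
    open ≡-Reasoning
    P : List (Fin n) → Bool
    P xs = isCycleᵇ G xs ∧ startsWithᵇ G v w xs
    not-first : ∀ {x} → x ≢ v → ∀ ys → P (x ∷ ys) ≡ false
    not-first {x} x≢v []       = ∧-zeroʳ (isCycleᵇ G (x ∷ []))
    not-first {x} x≢v (y ∷ ys) =
      trans (cong (λ b → isCycleᵇ G (x ∷ y ∷ ys) ∧ (b ∧ ⌊ w ≟ y ⌋)) (≟-false (≢-sym x≢v))) (∧-zeroʳ _)
    not-second : ∀ {y} → y ≢ w → ∀ zs → P (v ∷ y ∷ zs) ≡ false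
    not-second {y} y≢w zs = trans (cong (λ b → isCycleᵇ G (v ∷ y ∷ zs) ∧ (⌊ v ≟ v ⌋ ∧ b)) (≟-false (≢-sym y≢w)))
                                  (trans (cong (isCycleᵇ G (v ∷ y ∷ zs) ∧_) (∧-zeroʳ _)) (∧-zeroʳ _))

module ClosedWalks {n} (G : Graph n) {k} (regular : Regular G k) {g} (girth : Girth G g) where

  open import Data.Bool using (true; false)
  open import Data.Bool.Properties using (∧-conicalˡ; T-≡)
  open import Data.Empty using (⊥; ⊥-elim)
  open import Data.Fin using (_≟_)
  open import Data.List using ([]; _∷_; _++_; length)
  open import Data.Nat using (ℕ; zero; suc; _+_; _*_; _≤_; _<_; _≤?_; s≤s; z≤n)
  open import Data.Nat.Properties hiding (_≟_)
  open import Data.Product using (Σ; _,_; proj₁; proj₂)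
  open import Function.Bundles using (Equivalence)
  open import Relation.Binary.Definitions using (tri<; tri≈; tri>)
  open import Relation.Binary.PropositionalEquality
  open import Relation.Nullary using (contradiction)
  open import Relation.Nullary.Decidable using (yes; no)
  open import Defs using (adj; isCycleᵇ; cycleCount; treeWalks; c)
  open Sums
  open TreeWalks
  open Walks G regular
  open NonBacktracking G regular
  open Paths G
  open CycleCompletions G

  3≤g : 3 ≤ g
  3≤g = let xs , len , cyc = proj₁ girth in
    subst (3 ≤_) len (≤ᵇ⇒≤ 3 (length xs) (Equivalence.from T-≡ (∧-conicalˡ _ _ cyc)))

  no-early-return : ∀ q p u w → IsPath (q ++ p ∷ u ∷ []) → w ∈ᵇ (q ++ p ∷ u ∷ []) ≡ true → adj G u w ≡ true →
    w ≢ p → length (q ++ p ∷ u ∷ []) < g → ⊥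
  no-early-return q p u w path w∈ uw w≢p short =
    let xs , cyc , len = short-cycle q p u w path w∈ uw w≢p in <⇒≱ short (≤-trans (proj₂ girth xs cyc) len)

  -- Stepping back onto the path q ++ p ∷ u ∷ [] would close a cycle shorter than g.
  nbWalksAfter-revisit : ∀ d q p u y → IsPath (q ++ p ∷ u ∷ []) → y ∈ᵇ (q ++ p ∷ u ∷ []) ≡ true → y ≢ u →
    length (q ++ p ∷ u ∷ []) + d ≤ g → nbWalksAfter d p u y ≡ 0
  nbWalksAfter-revisit zero    q p u y _    _  y≢u _     = δ-≢ (≢-sym y≢u)
  nbWalksAfter-revisit (suc d) q p u y path y∈ y≢u bound = ∑-A-zero _ term
    where
    P = q ++ p ∷ u ∷ []
    bound′ : suc (length P + d) ≤ g
    bound′ = subst (_≤ g) (+-suc (length P) d) bound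
    term : ∀ w → adj G u w ≡ true → δᶜ p w * nbWalksAfter d u w y ≡ 0
    term w uw with p ≟ w
    ... | yes refl = cong (_* nbWalksAfter d u p y) (δᶜ-refl p)
    ... | no p≢w with w ∈ᵇ P in w∈
    ...   | true  = ⊥-elim (no-early-return q p u w path w∈ uw (≢-sym p≢w) (≤-trans (s≤s (m≤m+n _ d)) bound′))
    ...   | false = trans (cong (δᶜ p w *_) (nbWalksAfter-revisit d (q ++ p ∷ []) u w y (IsPath-extend q path uw w∈)
                            (subst (λ xs → y ∈ᵇ xs ≡ true) (extend-assoc q p u w) (∈ᵇ-++⁺ˡ P (w ∷ []) y∈))
                            (∈ᵇ-∉-≢ P y∈ w∈)
                            (subst (λ m → m + d ≤ g) (sym (length-extend q p u w)) bound′)))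
                          (*-zeroʳ (δᶜ p w))

  nbWalksAfter-one-closing : ∀ q p u {x rest} → q ++ p ∷ u ∷ [] ≡ x ∷ rest → IsPath (q ++ p ∷ u ∷ []) →
    3 ≤ length (q ++ p ∷ u ∷ []) → nbWalksAfter 1 p u x ≡ ⟦ isCycleᵇ G (q ++ p ∷ u ∷ []) ⟧
  nbWalksAfter-one-closing q p u {x} eq path long = begin
    ∑ (λ w → A u w * (δᶜ p w * δ w x))
      ≡⟨ ∑-single x _ (λ w w≢x → trans (cong (λ z → A u w * (δᶜ p w * z)) (δ-≢ w≢x))
                                       (trans (cong (A u w *_) (*-zeroʳ (δᶜ p w))) (*-zeroʳ (A u w)))) ⟩
    A u x * (δᶜ p x * δ x x)
      ≡⟨ cong₂ (λ a b → A u x * (a * b)) (δᶜ-≢ (first-≢-penultimate q eq (proj₁ path) long)) (δ-refl x) ⟩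
    A u x * 1
      ≡⟨ *-identityʳ (A u x) ⟩
    ⟦ adj G u x ⟧
      ≡⟨ cong ⟦_⟧ (sym (isCycleᵇ-closing q eq path long)) ⟩
    ⟦ isCycleᵇ G (q ++ p ∷ u ∷ []) ⟧ ∎
    where open ≡-Reasoning

  nbWalksAfter-close : ∀ d q p u {x rest} → q ++ p ∷ u ∷ [] ≡ x ∷ rest → IsPath (q ++ p ∷ u ∷ []) →
    length (q ++ p ∷ u ∷ []) + d ≡ g → nbWalksAfter (suc d) p u x ≡ completions d (q ++ p ∷ u ∷ [])
  nbWalksAfter-close zero q p u eq path len =
    trans (nbWalksAfter-one-closing q p u eq path long) (sym (completions-zero (q ++ p ∷ u ∷ [])))
    where
    long : 3 ≤ length (q ++ p ∷ u ∷ [])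
    long = subst (3 ≤_) (trans (sym len) (+-identityʳ _)) 3≤g
  nbWalksAfter-close (suc d) q p u {x} eq path len = trans (sum-cong-≗ term) (sym (completions-suc d P))
    where
    P = q ++ p ∷ u ∷ []
    P<g : length P < g
    P<g = subst (length P <_) len (m<m+n (length P) (s≤s z≤n))
    term : ∀ w → A u w * (δᶜ p w * nbWalksAfter (suc d) u w x) ≡ completions d (P ++ w ∷ [])
    term w with adj G u w in uw
    ... | false = sym (completions-nonadjacent d q uw)
    ... | true with p ≟ w
    ...   | yes refl = trans (cong (λ z → z * nbWalksAfter (suc d) u p x + 0) (δᶜ-refl p))
                             (sym (completions-revisit d P (∈ᵇ-++⁺ʳ q (p ∷ u ∷ []) (∈ᵇ-here p (u ∷ [])))))
    ...   | no p≢w with w ∈ᵇ P in w∈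
    ...     | true  = ⊥-elim (no-early-return q p u w path w∈ uw (≢-sym p≢w) P<g)
    ...     | false = begin
      δᶜ p w * nbWalksAfter (suc d) u w x + 0
        ≡⟨ trans (+-identityʳ _) (trans (cong (_* nbWalksAfter (suc d) u w x) (δᶜ-≢ p≢w)) (+-identityʳ _)) ⟩
      nbWalksAfter (suc d) u w x
        ≡⟨ nbWalksAfter-close d (q ++ p ∷ []) u w (trans (sym (extend-assoc q p u w)) (cong (_++ w ∷ []) eq))
             (IsPath-extend q path uw w∈) (trans (cong (_+ d) (length-extend q p u w)) (trans (sym (+-suc (length P) d)) len)) ⟩
      completions d ((q ++ p ∷ []) ++ u ∷ w ∷ [])
        ≡⟨ cong (completions d) (sym (extend-assoc q p u w)) ⟩
      completions d (P ++ w ∷ []) ∎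
      where open ≡-Reasoning

  nbWalks-below-girth : ∀ d v → suc d < g → nbWalks (suc d) v v ≡ 0
  nbWalks-below-girth d v d<g = ∑-A-zero _ λ w vw →
    nbWalksAfter-revisit d [] v w v (edge-IsPath vw) (∈ᵇ-here v (w ∷ [])) (adjacent-≢ vw) d<g

  girth-≥2 : Σ ℕ λ m → suc (suc m) ≡ g
  girth-≥2 with 3≤g
  ... | s≤s (s≤s _) = _ , refl

  nbWalks-girth : ∀ v → nbWalks g v v ≡ ∑ λ w → A v w * cycleCount G g v w
  nbWalks-girth v with girth-≥2
  ... | m , refl = ∑-A-cong λ w vw →
    trans (nbWalksAfter-close m [] v w refl (edge-IsPath vw) refl) (sym (cycleCount-completions m v w))

  walks-below-girth : ∀ ℓ v → ℓ < g → walks ℓ v v ≡ c ℓ k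
  walks-below-girth ℓ v ℓ<g = begin
    walks ℓ v v                                          ≡⟨ walks-nbWalks ℓ v v ⟩
    ∑< (2 + ℓ) (λ d → treeWalks k ℓ d * nbWalks d v v)   ≡⟨ ∑<-single {2 + ℓ} _ (s≤s z≤n) others ⟩
    c ℓ k * δ v v                                        ≡⟨ trans (cong (c ℓ k *_) (δ-refl v)) (*-identityʳ _) ⟩
    c ℓ k                                                ∎
    where
    open ≡-Reasoning
    others : ∀ d → d ≢ 0 → treeWalks k ℓ d * nbWalks d v v ≡ 0
    others zero    d≢0 = contradiction refl d≢0
    others (suc d) _   with suc d ≤? ℓ
    ... | yes d<ℓ = trans (cong (treeWalks k ℓ (suc d) *_) (nbWalks-below-girth d v (≤-<-trans d<ℓ ℓ<g)))
                          (*-zeroʳ (treeWalks k ℓ (suc d)))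
    ... | no  d≮ℓ = cong (_* nbWalks (suc d) v v) (treeWalks-vanish k (≰⇒> d≮ℓ))

  walks-girth : ∀ v → walks g v v ≡ c g k + ∑ (λ w → A v w * cycleCount G g v w)
  walks-girth v with girth-≥2
  ... | m , refl = begin
    walks g v v
      ≡⟨ walks-nbWalks g v v ⟩
    c g k * δ v v + ∑< (suc g) (λ d → treeWalks k g (suc d) * nbWalks (suc d) v v)
      ≡⟨ cong₂ _+_ (trans (cong (c g k *_) (δ-refl v)) (*-identityʳ _)) (∑<-single _ (m<n⇒m<1+n (n<1+n (suc m))) others) ⟩
    c g k + treeWalks k g g * nbWalks g v v
      ≡⟨ cong (c g k +_) (trans (cong (_* nbWalks g v v) (treeWalks-diag k g)) (trans (+-identityʳ _) (nbWalks-girth v))) ⟩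
    c g k + ∑ (λ w → A v w * cycleCount G g v w) ∎
    where
    open ≡-Reasoning
    others : ∀ d → d ≢ suc m → treeWalks k g (suc d) * nbWalks (suc d) v v ≡ 0
    others d d≢ with <-cmp d (suc m)
    ... | tri< d<m _ _ = trans (cong (treeWalks k g (suc d) *_) (nbWalks-below-girth d v (s≤s d<m)))
                               (*-zeroʳ (treeWalks k g (suc d)))
    ... | tri≈ _ d≡m _ = contradiction d≡m d≢
    ... | tri> _ _ m<d = cong (_* nbWalks (suc d) v v) (treeWalks-vanish k (s≤s m<d))

module HalfGirthWalks {n} (G : Graph n) {k g} (a : Vec ℕ k) (girth-regular : GirthRegular G k g a)
                      (g-even : g % 2 ≡ 0) where

  open import Data.Bool using (Bool; true; false)
  open import Data.Bool.Properties using (∧-conicalˡ)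
  open import Data.Fin using (Fin)
  open import Data.List using ([]; _∷_; allFin; map)
  open import Data.Nat using (zero; suc; _+_; _*_; _^_; _≤_; _<_; _/_; s≤s; z≤n)
  open import Data.Nat.DivMod using (m≡m%n+[m/n]*n)
  open import Data.Nat.ListAction using () renaming (sum to sumᴸ)
  open import Data.Nat.ListAction.Properties using (sum-↭)
  open import Data.Nat.Properties using (^-distribˡ-+-*; m<m+n)
  open import Data.Nat.Tactic.RingSolver using (solve-∀)
  open import Data.Product using (Σ; _,_; proj₁; proj₂)
  import Data.Vec as Vec
  open import Function using (id)
  open import Relation.Binary.PropositionalEquality
  open import Relation.Nullary using (contradiction)
  open import Defs using (adj; cycleCount; signatureList; c)
  open Sums

  regular : Regular G k
  regular = proj₁ (proj₂ girth-regular)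

  girth : Girth G g
  girth = proj₁ (proj₂ (proj₂ girth-regular))

  open Walks G regular
  open ClosedWalks G regular girth

  h : ℕ
  h = g / 2

  g≡h+h : g ≡ h + h
  g≡h+h = trans (m≡m%n+[m/n]*n g 2) (trans (cong (_+ h * 2) g-even) (double h))
    where
    double : ∀ h → 0 + h * 2 ≡ h + h
    double = solve-∀

  h<g : h < g
  h<g with h | g≡h+h
  ... | zero  | g≡0 = contradiction (subst (3 ≤_) g≡0 3≤g) λ ()
  ... | suc m | g≡  = subst (suc m <_) (sym g≡) (m<m+n (suc m) (s≤s z≤n))

  k^g≡k^h*k^h : k ^ g ≡ k ^ h * k ^ h
  k^g≡k^h*k^h = trans (cong (k ^_) g≡h+h) (^-distribˡ-+-* k h h)

  signature-sum : ∀ v → ∑ (λ w → A v w * cycleCount G g v w) ≡ Vec.sum a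
  signature-sum v = begin
    ∑ (λ w → A v w * cycleCount G g v w)                   ≡⟨ sym (sum-map-tabulate (λ w → A v w * cycleCount G g v w) id) ⟩
    sumᴸ (map (λ w → A v w * cycleCount G g v w) (allFin n)) ≡⟨ sym (sum-map-filterᵇ (adj G v) (cycleCount G g v) (allFin n)) ⟩
    sumᴸ (signatureList G g v)                             ≡⟨ sum-↭ (proj₂ (proj₂ (proj₂ girth-regular)) v) ⟩
    sumᴸ (Vec.toList a)                                    ≡⟨ sum-toList a ⟩
    Vec.sum a                                              ∎
    where open ≡-Reasoning

  row-diagonal : ∀ u → walks h u u ≡ c h k
  row-diagonal u = walks-below-girth h u h<g

  row-sum-squares : ∀ u → ∑ (λ v → walks h u v * walks h u v) ≡ c g k + Vec.sum a
  row-sum-squares u = begin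
    ∑ (λ v → walks h u v * walks h u v)            ≡⟨ ∑-walks² h u ⟩
    walks (h + h) u u                              ≡⟨ cong (λ ℓ → walks ℓ u u) (sym g≡h+h) ⟩
    walks g u u                                    ≡⟨ walks-girth u ⟩
    c g k + ∑ (λ w → A u w * cycleCount G g u w)   ≡⟨ cong (c g k +_) (signature-sum u) ⟩
    c g k + Vec.sum a                              ∎
    where open ≡-Reasoning

  an-edge : Σ (Fin n) λ u → Σ (Fin n) λ v → adj G u v ≡ true
  an-edge with proj₁ girth
  ... | u ∷ v ∷ rest , _ , cycle = u , v , ∧-conicalˡ (adj G u v) true (proj₂ (Paths.cycle-IsPath G (u ∷ v ∷ []) rest cycle))

  odd-walks-bound : ∀ (p : Fin n → Bool) u → (∀ v → p v ≡ false → walks h u v ≡ 0) →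
    k ^ g ≤ count p * (c g k + Vec.sum a)
  odd-walks-bound p u vanish = subst₂ _≤_
    (trans (cong₂ _*_ (∑-walks h u) (∑-walks h u)) (sym k^g≡k^h*k^h))
    (cong (count p *_) (row-sum-squares u))
    (cauchy-schwarz-support p (walks h u) vanish)

module OrderBounds {n} (G : Graph n) {k g} (a : Vec ℕ k) (girth-regular : GirthRegular G k g a)
                   (g-even : g % 2 ≡ 0) where

  open import Data.Bool using (Bool; true; false; not)
  open import Data.Bool.Properties using (¬-not; not-injective)
  import Data.Bool as Bool
  open import Data.Fin using (Fin)
  open import Data.Integer using (+_; _+_; _-_; _*_; _≤_; 0ℤ; 1ℤ; +≤+)
  open import Data.Integer.Properties using (pos-+; pos-*; +-mono-≤; *-distribʳ-+; module ≤-Reasoning)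
  open import Data.Integer.Tactic.RingSolver using (solve-∀)
  import Data.Nat as ℕ
  import Data.Nat.Properties as ℕ
  open import Data.Nat using (parity)
  open import Data.Parity.Base using (0ℙ; 1ℙ)
  open import Data.Product using (Σ; _,_; proj₁; proj₂)
  import Data.Vec as Vec
  open import Function using (_∘_)
  open import Relation.Binary.PropositionalEquality
  open import Relation.Nullary using (contradiction)
  open import Relation.Nullary.Decidable using (yes; no)
  open import Defs using (c; num0; den0; num2; den2; num2bip; Bipartite)
  open Sums using (count; count-true; count-complement)
  open TreeWalks using (treeWalks-parity)
  open HalfParity
  open Variance
  open HalfGirthWalks G a girth-regular g-even
  open Walks G regular

  s : ℕ
  s = Vec.sum a

  bound-from-row : ∀ {N K Q D} → (+ K - + D) * (+ K - + D) ≤ (+ N - 1ℤ) * (+ Q - + D * + D) →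
    K ≡ k ℕ.^ h → Q ≡ c g k ℕ.+ s → D ≡ c h k → num0 k g s ≤ + N * den0 k g s
  bound-from-row {N} cs refl refl refl = subst₂ _≤_ num0≡ den0≡ (variance-bound (+ N) K Q D cs)
    where
    K = + (k ℕ.^ h)
    Q = + (c g k ℕ.+ s)
    D = + c h k
    swap : ∀ x y z → x + y - z ≡ x - z + y
    swap = solve-∀
    num0≡ : Q + K * K - + 2 * D * K ≡ num0 k g s
    num0≡ = cong₂ (λ x y → x + y - + 2 * D * K) (pos-+ (c g k) s)
                  (sym (trans (cong +_ k^g≡k^h*k^h) (pos-* (k ℕ.^ h) (k ℕ.^ h))))
    den0≡ : + N * (Q - D * D) ≡ + N * den0 k g s
    den0≡ = cong (+ N *_) (trans (cong (_- D * D) (pos-+ (c g k) s)) (swap (+ c g k) (+ s) (D * D)))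

  class-bound : ∀ (p : Fin n → Bool) u → p u ≡ true → (∀ v → p v ≡ false → walks h u v ≡ 0) →
    num0 k g s ≤ + count p * den0 k g s
  class-bound p u pu vanish = bound-from-row {count p} (off-diagonal-cauchy-schwarz p (walks h u) u pu vanish)
    (∑-walks h u) (row-sum-squares u) (row-diagonal u)

  order-bound : num0 k g s ≤ + n * den0 k g s
  order-bound = subst (λ N → num0 k g s ≤ + N * den0 k g s) (count-true {n})
    (class-bound (λ _ → true) (proj₁ an-edge) refl λ _ ())

  half-even : g % 4 ≡ 0 → parity h ≡ 0ℙ
  half-even g%4≡0 = even-half h (subst (λ m → m % 4 ≡ 0) g≡h+h g%4≡0)

  half-odd : g % 4 ≡ 2 → parity h ≡ 1ℙ
  half-odd g%4≡2 = odd-half h (subst (λ m → m % 4 ≡ 2) g≡h+h g%4≡2)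

  order-bound-odd-half : g % 4 ≡ 2 → num2 k g s ≤ + n * den2 k g s
  order-bound-odd-half g%4≡2 = subst₂ _≤_ num0≡num2 (cong (+ n *_) den0≡den2) order-bound
    where
    c-h≡0 : c h k ≡ 0
    c-h≡0 = treeWalks-parity k h 0 λ h-even → contradiction (trans (sym (half-odd g%4≡2)) h-even) λ ()
    drop : ∀ X K → X - + 2 * 0ℤ * K ≡ X
    drop = solve-∀
    drop′ : ∀ C S → C - 0ℤ * 0ℤ + S ≡ C + S
    drop′ = solve-∀
    num0≡num2 : num0 k g s ≡ num2 k g s
    num0≡num2 = trans (cong (λ z → num2 k g s - + 2 * + z * + (k ℕ.^ h)) c-h≡0) (drop (num2 k g s) (+ (k ℕ.^ h)))
    den0≡den2 : den0 k g s ≡ den2 k g s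
    den0≡den2 = trans (cong (λ z → + c g k - + z * + z + + s) c-h≡0) (drop′ (+ c g k) (+ s))

  module _ (bipartite : Bipartite G) where

    colour : Fin n → Bool
    colour = proj₁ bipartite

    open Colouring colour (proj₂ bipartite)

    coloured : ∀ b → Σ (Fin n) λ u → colour u ≡ b
    coloured b with an-edge
    ... | u , v , uv with colour u Bool.≟ b
    ...   | yes cu≡b = u , cu≡b
    ...   | no  cu≢b = v , not-injective (trans (sym (¬-not (proj₂ bipartite u v uv))) (¬-not cu≢b))

    u₀ u₁ : Fin n
    u₀ = proj₁ (coloured false)
    u₁ = proj₁ (coloured true)

    colour-u₀ : colour u₀ ≡ false
    colour-u₀ = proj₂ (coloured false)

    colour-u₁ : colour u₁ ≡ true
    colour-u₁ = proj₂ (coloured true)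

    bipartite-order-bound-even-half : g % 4 ≡ 0 → + 2 * num0 k g s ≤ + n * den0 k g s
    bipartite-order-bound-even-half g%4≡0 = begin
      + 2 * num0 k g s
        ≡⟨ double (num0 k g s) ⟩
      num0 k g s + num0 k g s
        ≤⟨ +-mono-≤ (class-bound colour u₁ colour-u₁ vanish₁)
                    (class-bound (not ∘ colour) u₀ (cong not colour-u₀) vanish₀) ⟩
      + count colour * den0 k g s + + count (not ∘ colour) * den0 k g s
        ≡⟨ sym (*-distribʳ-+ (den0 k g s) (+ count colour) (+ count (not ∘ colour))) ⟩
      (+ count colour + + count (not ∘ colour)) * den0 k g s
        ≡⟨ cong (_* den0 k g s) (trans (sym (pos-+ (count colour) (count (not ∘ colour)))) (cong +_ (count-complement colour))) ⟩
      + n * den0 k g s ∎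
      where
      open ≤-Reasoning
      double : ∀ x → + 2 * x ≡ x + x
      double = solve-∀
      across : ∀ {u v} → colour u ≢ colour v → walks h u v ≡ 0
      across = walks-even-across h (half-even g%4≡0)
      vanish₁ : ∀ v → colour v ≡ false → walks h u₁ v ≡ 0
      vanish₁ v cv = across λ c≡ → contradiction (trans (sym colour-u₁) (trans c≡ cv)) λ ()
      vanish₀ : ∀ v → not (colour v) ≡ false → walks h u₀ v ≡ 0
      vanish₀ v ncv = across λ c≡ → contradiction (trans (sym colour-u₀) (trans c≡ (not-injective ncv))) λ ()

    bipartite-order-bound-odd-half : g % 4 ≡ 2 → num2bip k g s ≤ + n * den2 k g s
    bipartite-order-bound-odd-half g%4≡2 =
      subst₂ _≤_ (pos-* 2 (k ℕ.^ g)) (trans (pos-* n Q) (cong (+ n *_) (pos-+ (c g k) s))) (+≤+ (begin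
        2 ℕ.* k ℕ.^ g
          ≡⟨ cong (k ℕ.^ g ℕ.+_) (ℕ.+-identityʳ _) ⟩
        k ℕ.^ g ℕ.+ k ℕ.^ g
          ≤⟨ ℕ.+-mono-≤ (odd-walks-bound colour u₀ vanish₀) (odd-walks-bound (not ∘ colour) u₁ vanish₁) ⟩
        count colour ℕ.* Q ℕ.+ count (not ∘ colour) ℕ.* Q
          ≡⟨ sym (ℕ.*-distribʳ-+ Q (count colour) (count (not ∘ colour))) ⟩
        (count colour ℕ.+ count (not ∘ colour)) ℕ.* Q
          ≡⟨ cong (ℕ._* Q) (count-complement colour) ⟩
        n ℕ.* Q ∎))
      where
      open ℕ.≤-Reasoning
      Q = c g k ℕ.+ s
      within : ∀ {u v} → colour u ≡ colour v → walks h u v ≡ 0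
      within = walks-odd-within h (half-odd g%4≡2)
      vanish₀ : ∀ v → colour v ≡ false → walks h u₀ v ≡ 0
      vanish₀ v cv = within (trans colour-u₀ (sym cv))
      vanish₁ : ∀ v → not (colour v) ≡ false → walks h u₁ v ≡ 0
      vanish₁ v ncv = within (trans colour-u₁ (sym (not-injective ncv)))

open import Defs
open import Data.Nat using (ℕ; _≤_; _%_)
open import Data.Vec using (Vec; sum)
open import Data.Integer using (+_; _*_) renaming (_≤_ to _≤ℤ_)
open import Data.Product using (_×_; _,_)
open import Relation.Binary.PropositionalEquality using (_≡_)

theorem4p3 : (k g : ℕ) (a : Vec ℕ k) → 3 ≤ k → g % 2 ≡ 0 → NonDecreasing a
    → GirthRegularExists k g a
    → (g % 4 ≡ 0
        → (∀ m → IsMinOrder k g a m → num0 k g (sum a) ≤ℤ + m * den0 k g (sum a))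
        × (∀ m → IsMinOrder₂ k g a m → + 2 * num0 k g (sum a) ≤ℤ + m * den0 k g (sum a)))
    × (g % 4 ≡ 2
        → (∀ m → IsMinOrder k g a m → num2 k g (sum a) ≤ℤ + m * den2 k g (sum a))
        × (∀ m → IsMinOrder₂ k g a m → num2bip k g (sum a) ≤ℤ + m * den2 k g (sum a)))
theorem4p3 k g a _ g-even _ _ =
  (λ g%4≡0 →
      (λ { m ((G , girth-regular) , _) → OrderBounds.order-bound G a girth-regular g-even })
    , (λ { m ((G , girth-regular , bipartite) , _) →
             OrderBounds.bipartite-order-bound-even-half G a girth-regular g-even bipartite g%4≡0 }))
  , (λ g%4≡2 →
      (λ { m ((G , girth-regular) , _) → OrderBounds.order-bound-odd-half G a girth-regular g-even g%4≡2 })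
    , (λ { m ((G , girth-regular , bipartite) , _) →
             OrderBounds.bipartite-order-bound-odd-half G a girth-regular g-even bipartite g%4≡2 }))
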